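{- Let $n\ge 2$ and let $\boldsymbol{\pi}\in\mathfrak{S}_n$ be an $Ln1$ permutation. Then a fundamental parallelepiped of the affine span of $\operatorname{conv}(\mathcal{S}^{\boldsymbol{\pi}})$ has $(n-1)$-dimensional Euclidean volume $\sqrt{n}$.
   Context: Permutations $\boldsymbol{\pi}=\pi_1\cdots\pi_n\in\mathfrak{S}_n$ are identified with points of $\mathbb{R}^n$; $\mathbf{e}=12\cdots n$. An $Ln1$ permutation is one with $\pi_{n-1}=n$ and $\pi_n=1$. The stack-sorting map $s$: start with an empty stack and read entries left to right; for each entry $x$, while the stack is nonempty and its top $t<x$, pop $t$ to the output; then push $x$. At the end, pop the remaining stack elements to the output; the output is $s(\boldsymbol{\pi})$. $\mathcal{S}^{\boldsymbol{\pi}}=\{\boldsymbol{\pi},s(\boldsymbol{\pi}),s^2(\boldsymbol{\pi}),\dots,\mathbf{e}\}$ (iterating until $\mathbf{e}$ is reached). A fundamental parallelepiped of an affine subspace $V$ (spanned by lattice points) is a parallelepiped whose generating vectors form a basis of the lattice of integer vectors parallel to $V$; all such have the same volume. -}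

module Defs where

open import Data.Nat as ℕ using (ℕ; zero; suc; _<?_)
open import Data.Nat.Properties using ()
open import Data.Integer as ℤ using (ℤ; +_)
open import Data.Rational as ℚ using (ℚ)
open import Data.Fin using (Fin; zero; suc; toℕ; punchIn)
open import Data.List using (List; []; _∷_; _++_; map; upTo)
open import Data.List.Relation.Binary.Permutation.Propositional using (_↭_)
open import Data.Product using (Σ; ∃; _×_; _,_)
open import Relation.Nullary using (yes; no)
open import Relation.Binary.PropositionalEquality using (_≡_)
open import Function using (_∘_)

-- Permutations of [n] in one-line notation, as lists of naturals.

IsPerm : ℕ → List ℕ → Set
IsPerm n π = π ↭ map suc (upTo n)

IsLn1 : ℕ → List ℕ → Set
IsLn1 n π = ∃ λ xs → π ≡ xs ++ (n ∷ 1 ∷ [])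

-- Stack-sorting map (stack as a list, top of stack = head).

popLess : ℕ → List ℕ → List ℕ × List ℕ
popLess x [] = [] , []
popLess x (t ∷ st) with t <? x
... | yes _ with popLess x st
...   | out , st' = t ∷ out , st'
popLess x (t ∷ st) | no _ = [] , t ∷ st

stackGo : List ℕ → List ℕ → List ℕ
stackGo st [] = st
stackGo st (x ∷ xs) with popLess x st
... | out , st' = out ++ stackGo (x ∷ st') xs

s : List ℕ → List ℕ
s = stackGo []

iter : ℕ → List ℕ → List ℕ
iter zero π = π
iter (suc k) π = s (iter k π)

-- p ∈ S^π  iff  p = s^k(π) for some k  (e is a fixed point of s)
-- Points of ℤ^n / ℚ^n.

nth : List ℕ → ℕ → ℕ
nth [] _ = 0
nth (x ∷ xs) zero = x
nth (x ∷ xs) (suc i) = nth xs i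

point : (n : ℕ) → List ℕ → Fin n → ℤ
point n p i = + nth p (toℕ i)

toℚ : ℤ → ℚ
toℚ z = z ℚ./ 1

sumℤ : ∀ {m} → (Fin m → ℤ) → ℤ
sumℤ {zero} f = + 0
sumℤ {suc m} f = f zero ℤ.+ sumℤ (f ∘ suc)

sumℚ : ∀ {m} → (Fin m → ℚ) → ℚ
sumℚ {zero} f = ℚ.0ℚ
sumℚ {suc m} f = f zero ℚ.+ sumℚ (f ∘ suc)

-- v (an integer vector) is parallel to the affine span of S^π, i.e. lies in
-- the ℚ-linear span of the differences s^k(π) - π.
InDir : (n : ℕ) → List ℕ → (Fin n → ℤ) → Set
InDir n π v = Σ ℕ λ N → Σ (Fin N → ℚ) λ c →
  ∀ i → toℚ (v i) ≡ sumℚ (λ k → c k ℚ.* toℚ (point n (iter (toℕ k) π) i ℤ.- point n π i))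

IsLatticeBasis : (n : ℕ) → List ℕ → ∀ {k} → (Fin k → Fin n → ℤ) → Set
IsLatticeBasis n π {k} b =
  (∀ j → InDir n π (b j)) ×
  (∀ (a : Fin k → ℤ) → (∀ i → sumℤ (λ j → a j ℤ.* b j i) ≡ + 0) → ∀ j → a j ≡ + 0) ×
  (∀ (v : Fin n → ℤ) → InDir n π v → Σ (Fin k → ℤ) λ a → ∀ i → v i ≡ sumℤ (λ j → a j ℤ.* b j i))

dot : ∀ {n} → (Fin n → ℤ) → (Fin n → ℤ) → ℤ
dot u v = sumℤ (λ i → u i ℤ.* v i)

gram : ∀ {k n} → (Fin k → Fin n → ℤ) → Fin k → Fin k → ℤ
gram b i j = dot (b i) (b j)

signℤ : ℕ → ℤ
signℤ zero = + 1
signℤ (suc m) = ℤ.- signℤ m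

det : ∀ {k} → (Fin k → Fin k → ℤ) → ℤ
det {zero} M = + 1
det {suc k} M = sumℤ (λ j → signℤ (toℕ j) ℤ.* (M zero j ℤ.* det (λ r c → M (suc r) (punchIn j c))))

{-# OPTIONS --safe #-}
-- For an Ln1 permutation π of length n = j₀ + 2, the t-th stack-sorting pass gives s^t(π) = σ (j₀+2−t) 1 (j₀+3−t) ⋯ n
-- with σ a rearrangement of 2, …, j₀+1−t (since s(L n R) = s(L) s(R) n), so s^(j₀+1)(π) = e. Hence the vectors
-- s^t(π) − e lie in the span of the differences s^k(π) − π and are triangular: the last nonzero entry, 1 − (j₀+2−t),
-- sits in position j₀ + 1 − t. As every s^k(π) is a permutation of π, the direction space of the affine span of
-- S^π is exactly the hyperplane Σ v = 0, and the lattice of integer vectors parallel to it is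
-- {v ∈ ℤⁿ : Σ v = 0}. Any ℤ-basis b of that lattice is related to the basis e_(i+1) − e₀ by a unimodular matrix A, so
-- b has n − 1 elements (compare traces of A A⁻¹ and A⁻¹ A) and Gram determinant det(A)² det(I + J) = n, the
-- squared volume of the fundamental parallelepiped. The determinant identities used (transpose invariance,
-- multiplicativity) come from characterising alternating multilinear forms as multiples of det.
module Submission where

open import Defs
open import Algebra.Bundles using (CommutativeRing)
open import Data.Nat using (ℕ; zero; suc; _≤_; _∸_; z≤n; s≤s)
open import Data.Fin using (Fin; zero; suc)
open import Data.List using (List)
open import Data.Integer using (ℤ; +_)
import Data.Integer.Properties as ℤ
import Data.Rational.Properties as ℚ
open import Data.Product using (_×_; _,_)
open import Function using (_∘_)
open import Relation.Binary.PropositionalEquality as ≡ using (_≡_; _≢_; refl)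

-- sumℤ and sumℚ unfold exactly like the library's sum, so its lemmas transfer along Σ≈sum.
module FinSum {c ℓ} (R : CommutativeRing c ℓ)
  (Σ : ∀ {m} → (Fin m → CommutativeRing.Carrier R) → CommutativeRing.Carrier R)
  (Σ-[] : ∀ (f : Fin 0 → CommutativeRing.Carrier R) → Σ f ≡ CommutativeRing.0# R)
  (Σ-∷ : ∀ {m} (f : Fin (suc m) → CommutativeRing.Carrier R) →
         Σ f ≡ CommutativeRing._+_ R (f zero) (Σ (f ∘ suc)))
  where

  open import Data.Fin using (punchIn)
  open import Data.Fin.Properties using (punchInᵢ≢i)
  open import Data.Fin.Permutation using (Permutation; _⟨$⟩ʳ_)
  open import Data.Empty using (⊥-elim)
  open CommutativeRing R hiding (zero; refl)
  open import Algebra.Properties.Semiring.Sum semiring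
  open import Algebra.Properties.Ring ring using (-‿+-comm; -0#≈0#)
  open import Relation.Binary.Reasoning.Setoid setoid

  Σ≈sum : ∀ {m} (f : Fin m → Carrier) → Σ f ≈ sum f
  Σ≈sum {zero} f = reflexive (Σ-[] f)
  Σ≈sum {suc m} f = trans (reflexive (Σ-∷ f)) (+-congˡ (Σ≈sum (f ∘ suc)))

  private
    via-sum : ∀ {m n} (f : Fin m → Carrier) (g : Fin n → Carrier) → sum f ≈ sum g → Σ f ≈ Σ g
    via-sum f g e = trans (Σ≈sum f) (trans e (sym (Σ≈sum g)))

  Σ-cong : ∀ {m} {f g : Fin m → Carrier} → (∀ i → f i ≈ g i) → Σ f ≈ Σ g
  Σ-cong {f = f} {g} e = via-sum f g (sum-cong-≋ e)

  Σ-distrib-+ : ∀ {m} (f g : Fin m → Carrier) → Σ (λ i → f i + g i) ≈ Σ f + Σ g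
  Σ-distrib-+ f g = begin
    Σ (λ i → f i + g i)  ≈⟨ Σ≈sum _ ⟩
    sum (λ i → f i + g i) ≈⟨ ∑-distrib-+ f g ⟩
    sum f + sum g        ≈⟨ +-cong (Σ≈sum f) (Σ≈sum g) ⟨
    Σ f + Σ g            ∎

  *-distribˡ-Σ : ∀ {m} x (f : Fin m → Carrier) → x * Σ f ≈ Σ (λ i → x * f i)
  *-distribˡ-Σ x f = trans (*-congˡ (Σ≈sum f)) (trans (*-distribˡ-sum x f) (sym (Σ≈sum _)))

  *-distribʳ-Σ : ∀ {m} x (f : Fin m → Carrier) → Σ f * x ≈ Σ (λ i → f i * x)
  *-distribʳ-Σ x f = trans (*-congʳ (Σ≈sum f)) (trans (*-distribʳ-sum x f) (sym (Σ≈sum _)))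

  -‿distrib-Σ : ∀ {m} (f : Fin m → Carrier) → - Σ f ≈ Σ (λ i → - f i)
  -‿distrib-Σ {zero} f = trans (-‿cong (reflexive (Σ-[] f))) (trans -0#≈0# (sym (reflexive (Σ-[] _))))
  -‿distrib-Σ {suc m} f = begin
    - Σ f                   ≈⟨ -‿cong (reflexive (Σ-∷ f)) ⟩
    - (f zero + Σ (f ∘ suc)) ≈⟨ -‿+-comm (f zero) (Σ (f ∘ suc)) ⟨
    - f zero + - Σ (f ∘ suc) ≈⟨ +-congˡ (-‿distrib-Σ (f ∘ suc)) ⟩
    - f zero + Σ (λ i → - f (suc i)) ≈⟨ reflexive (Σ-∷ _) ⟨
    Σ (λ i → - f i)          ∎

  Σ-comm : ∀ {m n} (f : Fin m → Fin n → Carrier) → Σ (λ i → Σ (f i)) ≈ Σ (λ j → Σ (λ i → f i j))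
  Σ-comm f = begin
    Σ (λ i → Σ (f i))                 ≈⟨ Σ-cong (λ i → Σ≈sum (f i)) ⟩
    Σ (λ i → sum (f i))               ≈⟨ Σ≈sum _ ⟩
    sum (λ i → sum (f i))             ≈⟨ ∑-comm f ⟩
    sum (λ j → sum (λ i → f i j))     ≈⟨ Σ≈sum _ ⟨
    Σ (λ j → sum (λ i → f i j))       ≈⟨ Σ-cong (λ j → Σ≈sum (λ i → f i j)) ⟨
    Σ (λ j → Σ (λ i → f i j))         ∎

  Σ-permute : ∀ {m} (f : Fin m → Carrier) (π : Permutation m m) → Σ f ≈ Σ (λ i → f (π ⟨$⟩ʳ i))
  Σ-permute f π = via-sum f _ (sum-permute f π)

  Σ-zeros : ∀ {m} (f : Fin m → Carrier) → (∀ i → f i ≈ 0#) → Σ f ≈ 0#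
  Σ-zeros {m} f z = trans (Σ≈sum f) (trans (sum-cong-≋ z) (sum-replicate-zero m))

  Σ-single : ∀ {m} (i : Fin m) (f : Fin m → Carrier) → (∀ j → j ≢ i → f j ≈ 0#) → Σ f ≈ f i
  Σ-single {suc m} i f z = begin
    Σ f                               ≈⟨ Σ≈sum f ⟩
    sum f                             ≈⟨ sum-remove f ⟩
    f i + sum (λ j → f (punchIn i j)) ≈⟨ +-congˡ (trans (sum-cong-≋ (λ j → z _ (punchInᵢ≢i i j))) (sum-replicate-zero m)) ⟩
    f i + 0#                          ≈⟨ +-identityʳ (f i) ⟩
    f i                               ∎

  δ : ∀ {m} → Fin m → Fin m → Carrier
  δ zero zero = 1#
  δ zero (suc _) = 0#
  δ (suc _) zero = 0#
  δ (suc i) (suc j) = δ i j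

  δ-diag : ∀ {m} (i : Fin m) → δ i i ≡ 1#
  δ-diag zero = refl
  δ-diag (suc i) = δ-diag i

  δ-off : ∀ {m} {i j : Fin m} → i ≢ j → δ i j ≡ 0#
  δ-off {i = zero} {zero} i≢j = ⊥-elim (i≢j refl)
  δ-off {i = zero} {suc j} _ = refl
  δ-off {i = suc i} {zero} _ = refl
  δ-off {i = suc i} {suc j} i≢j = δ-off (i≢j ∘ ≡.cong suc)

  δ-sym : ∀ {m} (i j : Fin m) → δ i j ≡ δ j i
  δ-sym zero zero = refl
  δ-sym zero (suc j) = refl
  δ-sym (suc i) zero = refl
  δ-sym (suc i) (suc j) = δ-sym i j

  δ-punchIn : ∀ {m} (j : Fin (suc m)) a b → δ (punchIn j a) (punchIn j b) ≡ δ a b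
  δ-punchIn zero a b = refl
  δ-punchIn (suc j) zero zero = refl
  δ-punchIn (suc j) zero (suc b) = refl
  δ-punchIn (suc j) (suc a) zero = refl
  δ-punchIn (suc j) (suc a) (suc b) = δ-punchIn j a b

  Σ-δˡ : ∀ {m} (i : Fin m) (f : Fin m → Carrier) → Σ (λ j → δ i j * f j) ≈ f i
  Σ-δˡ i f = begin
    Σ (λ j → δ i j * f j) ≈⟨ Σ-single i _ (λ j j≢i → trans (*-congʳ (reflexive (δ-off (j≢i ∘ ≡.sym)))) (zeroˡ (f j))) ⟩
    δ i i * f i           ≈⟨ *-congʳ (reflexive (δ-diag i)) ⟩
    1# * f i              ≈⟨ *-identityˡ (f i) ⟩
    f i                   ∎

  Σ-δʳ : ∀ {m} (i : Fin m) (f : Fin m → Carrier) → Σ (λ j → f j * δ j i) ≈ f i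
  Σ-δʳ i f = trans (Σ-cong (λ j → trans (*-comm (f j) (δ j i)) (*-congʳ (reflexive (δ-sym j i))))) (Σ-δˡ i f)

module Σℤ = FinSum ℤ.+-*-commutativeRing sumℤ (λ _ → refl) (λ _ → refl)
module Σℚ = FinSum ℚ.+-*-commutativeRing sumℚ (λ _ → refl) (λ _ → refl)

module Determinant where
  open import Data.Nat as ℕ using (ℕ; zero; suc)
  import Data.Nat.Properties as ℕ
  open import Data.Fin as Fin using (Fin; zero; suc; toℕ; inject₁; punchIn; punchOut)
  open import Data.Fin.Properties
    using (toℕ<n; toℕ-fromℕ<; toℕ-injective; toℕ-inject₁; suc-injective; punchIn-injective; punchIn-punchOut; punchInᵢ≢i)
  open import Data.Fin.Permutation using (Permutation; permutation)
  open import Data.Integer using (ℤ; +_; _+_; _*_; -_; _-_)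
  open import Data.Integer.Tactic.RingSolver using (solve-∀)
  open import Data.Product using (∃; _,_; proj₂)
  open import Data.Empty using (⊥-elim)
  open import Relation.Nullary using (yes; no)
  open import Relation.Binary.Definitions using (tri<; tri≈; tri>)
  open import Relation.Binary.PropositionalEquality using (cong; cong₂; sym; trans)
  open ≡.≡-Reasoning
  open import Algebra.Properties.AbelianGroup ℤ.+-0-abelianGroup using (identityʳ-unique; inverseˡ-unique)
  open Σℤ
    using (δ; δ-diag; δ-off; δ-sym; δ-punchIn; Σ-cong; Σ-distrib-+; *-distribˡ-Σ; *-distribʳ-Σ; -‿distrib-Σ; Σ-permute; Σ-single; Σ-δˡ; Σ-δʳ)

  Mat : ℕ → Set
  Mat m = Fin m → Fin m → ℤ

  _≋_ : ∀ {m} → Mat m → Mat m → Set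
  M ≋ N = ∀ r c → M r c ≡ N r c

  Id : ∀ {m} → Mat m
  Id = δ

  transpose : ∀ {m n} → (Fin m → Fin n → ℤ) → Fin n → Fin m → ℤ
  transpose M r c = M c r

  _⊗_ : ∀ {m n p} → (Fin m → Fin n → ℤ) → (Fin n → Fin p → ℤ) → Fin m → Fin p → ℤ
  (X ⊗ Y) r c = sumℤ (λ l → X r l * Y l c)

  minor : ∀ {k} → Fin (suc k) → Mat (suc k) → Mat k
  minor j M r c = M (suc r) (punchIn j c)

  laplaceTerm : ∀ {k} → Mat (suc k) → Fin (suc k) → ℤ
  laplaceTerm M j = signℤ (toℕ j) * (M zero j * det (minor j M))

  det-cong : ∀ {m} {M N : Mat m} → M ≋ N → det M ≡ det N
  det-cong {zero} _ = refl
  det-cong {suc m} M≋N = Σ-cong λ j →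
    cong₂ (λ x y → signℤ (toℕ j) * (x * y)) (M≋N zero j) (det-cong (λ r c → M≋N (suc r) (punchIn j c)))

  det-unitRow : ∀ {k} {M : Mat (suc k)} j → (∀ c → M zero c ≡ δ j c) → det M ≡ signℤ (toℕ j) * det (minor j M)
  det-unitRow {M = M} j M0≡δ = begin
    det M                                         ≡⟨ Σ-single j (laplaceTerm M) off ⟩
    signℤ (toℕ j) * (M zero j * det (minor j M))  ≡⟨ cong (λ x → signℤ (toℕ j) * (x * det (minor j M))) (trans (M0≡δ j) (δ-diag j)) ⟩
    signℤ (toℕ j) * (+ 1 * det (minor j M))       ≡⟨ cong (signℤ (toℕ j) *_) (ℤ.*-identityˡ (det (minor j M))) ⟩
    signℤ (toℕ j) * det (minor j M)               ∎
    where
    off : ∀ l → l ≢ j → laplaceTerm M l ≡ + 0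
    off l l≢j = trans (cong (λ x → signℤ (toℕ l) * (x * det (minor l M))) (trans (M0≡δ l) (δ-off (l≢j ∘ sym))))
                      (ℤ.*-zeroʳ (signℤ (toℕ l)))

  det-Id : ∀ {m} → det (Id {m}) ≡ + 1
  det-Id {zero} = refl
  det-Id {suc m} = trans (det-unitRow {M = Id {suc m}} zero (λ _ → refl)) (trans (ℤ.*-identityˡ (det (Id {m}))) (det-Id {m}))

  det-columnLinear : ∀ {m} q a {M N P : Mat m} →
    (∀ r c → c ≢ q → M r c ≡ P r c) → (∀ r c → c ≢ q → N r c ≡ P r c) →
    (∀ r → P r q ≡ a * M r q + N r q) → det P ≡ a * det M + det N
  det-columnLinear {suc k} q a {M} {N} {P} M∼P N∼P Pq = begin
    det P                                                ≡⟨ Σ-cong termwise ⟩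
    sumℤ (λ j → a * laplaceTerm M j + laplaceTerm N j)   ≡⟨ Σ-distrib-+ (λ j → a * laplaceTerm M j) (laplaceTerm N) ⟩
    sumℤ (λ j → a * laplaceTerm M j) + det N             ≡⟨ cong (_+ det N) (*-distribˡ-Σ a (laplaceTerm M)) ⟨
    a * det M + det N                                    ∎
    where
    termwise : ∀ j → laplaceTerm P j ≡ a * laplaceTerm M j + laplaceTerm N j
    termwise j with j Fin.≟ q
    ... | yes refl = begin
      σ * (P zero j * det (minor j P))                       ≡⟨ cong (λ x → σ * (x * det (minor j P))) (Pq zero) ⟩
      σ * ((a * M zero j + N zero j) * det (minor j P))      ≡⟨ distribute σ a (M zero j) (N zero j) (det (minor j P)) ⟩
      a * (σ * (M zero j * det (minor j P))) + σ * (N zero j * det (minor j P))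
        ≡⟨ cong₂ (λ x y → a * (σ * (M zero j * x)) + σ * (N zero j * y)) (minor-det M∼P) (minor-det N∼P) ⟨
      a * laplaceTerm M j + laplaceTerm N j                  ∎
      where
      σ = signℤ (toℕ j)
      minor-det : ∀ {X} → (∀ r c → c ≢ q → X r c ≡ P r c) → det (minor j X) ≡ det (minor j P)
      minor-det X∼P = det-cong (λ r c → X∼P (suc r) (punchIn j c) (punchInᵢ≢i j c))
      distribute : ∀ σ a x y d → σ * ((a * x + y) * d) ≡ a * (σ * (x * d)) + σ * (y * d)
      distribute = solve-∀
    ... | no j≢q = begin
      σ * (P zero j * det (minor j P))                           ≡⟨ cong₂ (λ x y → σ * (x * y)) (sym (M∼P zero j j≢q)) minorLinear ⟩
      σ * (M zero j * (a * det (minor j M) + det (minor j N)))   ≡⟨ distribute σ a (M zero j) (det (minor j M)) (det (minor j N)) ⟩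
      a * laplaceTerm M j + σ * (M zero j * det (minor j N))
        ≡⟨ cong (λ x → a * laplaceTerm M j + σ * (x * det (minor j N))) (trans (M∼P zero j j≢q) (sym (N∼P zero j j≢q))) ⟩
      a * laplaceTerm M j + laplaceTerm N j                      ∎
      where
      σ = signℤ (toℕ j)
      q′ = punchOut j≢q
      punchIn≢q : ∀ c → c ≢ q′ → punchIn j c ≢ q
      punchIn≢q c c≢q′ e = c≢q′ (punchIn-injective j c q′ (trans e (sym (punchIn-punchOut j≢q))))
      minorLinear : det (minor j P) ≡ a * det (minor j M) + det (minor j N)
      minorLinear = det-columnLinear q′ a
        (λ r c c≢q′ → M∼P (suc r) (punchIn j c) (punchIn≢q c c≢q′))
        (λ r c c≢q′ → N∼P (suc r) (punchIn j c) (punchIn≢q c c≢q′))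
        (λ r → ≡.subst (λ c → P (suc r) c ≡ a * M (suc r) c + N (suc r) c) (sym (punchIn-punchOut j≢q)) (Pq (suc r)))
      distribute : ∀ σ a x d e → σ * (x * (a * d + e)) ≡ a * (σ * (x * d)) + σ * (x * e)
      distribute = solve-∀

  adjSwap : ∀ {k} → Fin k → Fin (suc k) → Fin (suc k)
  adjSwap zero zero = suc zero
  adjSwap zero (suc zero) = zero
  adjSwap zero (suc (suc c)) = suc (suc c)
  adjSwap (suc i) zero = zero
  adjSwap (suc i) (suc c) = suc (adjSwap i c)

  adjSwap-involutive : ∀ {k} (i : Fin k) c → adjSwap i (adjSwap i c) ≡ c
  adjSwap-involutive zero zero = refl
  adjSwap-involutive zero (suc zero) = refl
  adjSwap-involutive zero (suc (suc c)) = refl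
  adjSwap-involutive (suc i) zero = refl
  adjSwap-involutive (suc i) (suc c) = cong suc (adjSwap-involutive i c)

  adjSwap-inject₁ : ∀ {k} (i : Fin k) → adjSwap i (inject₁ i) ≡ suc i
  adjSwap-inject₁ zero = refl
  adjSwap-inject₁ (suc i) = cong suc (adjSwap-inject₁ i)

  adjSwap-suc : ∀ {k} (i : Fin k) → adjSwap i (suc i) ≡ inject₁ i
  adjSwap-suc zero = refl
  adjSwap-suc (suc i) = cong suc (adjSwap-suc i)

  adjSwap-other : ∀ {k} (i : Fin k) {c} → c ≢ inject₁ i → c ≢ suc i → adjSwap i c ≡ c
  adjSwap-other zero {zero} c≢i _ = ⊥-elim (c≢i refl)
  adjSwap-other zero {suc zero} _ c≢i+1 = ⊥-elim (c≢i+1 refl)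
  adjSwap-other zero {suc (suc c)} _ _ = refl
  adjSwap-other (suc i) {zero} _ _ = refl
  adjSwap-other (suc i) {suc c} c≢i c≢i+1 = cong suc (adjSwap-other i (c≢i ∘ cong suc) (c≢i+1 ∘ cong suc))

  adjSwap-punchIn-inject₁ : ∀ {k} (i : Fin k) c → adjSwap i (punchIn (inject₁ i) c) ≡ punchIn (suc i) c
  adjSwap-punchIn-inject₁ zero zero = refl
  adjSwap-punchIn-inject₁ zero (suc c) = refl
  adjSwap-punchIn-inject₁ (suc i) zero = refl
  adjSwap-punchIn-inject₁ (suc i) (suc c) = cong suc (adjSwap-punchIn-inject₁ i c)

  adjSwap-punchIn-suc : ∀ {k} (i : Fin k) c → adjSwap i (punchIn (suc i) c) ≡ punchIn (inject₁ i) c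
  adjSwap-punchIn-suc zero zero = refl
  adjSwap-punchIn-suc zero (suc c) = refl
  adjSwap-punchIn-suc (suc i) zero = refl
  adjSwap-punchIn-suc (suc i) (suc c) = cong suc (adjSwap-punchIn-suc i c)

  adjSwap-punchIn : ∀ {k} (i : Fin (suc k)) j → j ≢ inject₁ i → j ≢ suc i →
    ∃ λ i′ → ∀ c → adjSwap i (punchIn j c) ≡ punchIn j (adjSwap i′ c)
  adjSwap-punchIn zero zero j≢i _ = ⊥-elim (j≢i refl)
  adjSwap-punchIn zero (suc zero) _ j≢i+1 = ⊥-elim (j≢i+1 refl)
  adjSwap-punchIn {zero} zero (suc (suc ())) _ _
  adjSwap-punchIn {suc k} zero (suc (suc j)) _ _ = zero , commute
    where
    commute : ∀ c → adjSwap zero (punchIn (suc (suc j)) c) ≡ punchIn (suc (suc j)) (adjSwap zero c)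
    commute zero = refl
    commute (suc zero) = refl
    commute (suc (suc c)) = refl
  adjSwap-punchIn {suc k} (suc i) zero _ _ = i , λ c → refl
  adjSwap-punchIn {suc k} (suc i) (suc j) j≢i j≢i+1
    with i′ , commute ← adjSwap-punchIn i j (j≢i ∘ cong suc) (j≢i+1 ∘ cong suc) = suc i′ , commute′
    where
    commute′ : ∀ c → adjSwap (suc i) (punchIn (suc j) c) ≡ punchIn (suc j) (adjSwap (suc i′) c)
    commute′ zero = refl
    commute′ (suc c) = cong suc (commute c)

  adjSwapPermutation : ∀ {k} → Fin k → Permutation (suc k) (suc k)
  adjSwapPermutation i = permutation (adjSwap i) (adjSwap i) (adjSwap-involutive i) (adjSwap-involutive i)

  det-adjSwapColumns : ∀ {k} (i : Fin k) (M : Mat (suc k)) → det (λ r c → M r (adjSwap i c)) ≡ - det M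
  det-adjSwapColumns {suc k} i M = begin
    det M′                                     ≡⟨ Σ-cong termwise ⟩
    sumℤ (λ j → - laplaceTerm M (adjSwap i j)) ≡⟨ -‿distrib-Σ (λ j → laplaceTerm M (adjSwap i j)) ⟨
    - sumℤ (λ j → laplaceTerm M (adjSwap i j)) ≡⟨ cong -_ (Σ-permute (laplaceTerm M) (adjSwapPermutation i)) ⟨
    - det M                                    ∎
    where
    M′ : Mat (suc (suc k))
    M′ r c = M r (adjSwap i c)
    signs : signℤ (toℕ (suc i)) ≡ - signℤ (toℕ (inject₁ i))
    signs = cong (λ t → - signℤ t) (sym (toℕ-inject₁ i))
    swapped : ∀ j j′ → signℤ (toℕ j) ≡ - signℤ (toℕ j′) → adjSwap i j ≡ j′ → minor j M′ ≋ minor j′ M →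
              laplaceTerm M′ j ≡ - laplaceTerm M j′
    swapped j j′ sign-j entry-j minors = begin
      signℤ (toℕ j) * (M zero (adjSwap i j) * det (minor j M′))
        ≡⟨ cong₂ (λ x y → signℤ (toℕ j) * (M zero x * y)) entry-j (det-cong minors) ⟩
      signℤ (toℕ j) * (M zero j′ * det (minor j′ M))            ≡⟨ cong (_* (M zero j′ * det (minor j′ M))) sign-j ⟩
      - signℤ (toℕ j′) * (M zero j′ * det (minor j′ M))         ≡⟨ ℤ.neg-distribˡ-* (signℤ (toℕ j′)) _ ⟨
      - laplaceTerm M j′                                        ∎
    termwise : ∀ j → laplaceTerm M′ j ≡ - laplaceTerm M (adjSwap i j)
    termwise j with j Fin.≟ inject₁ i | j Fin.≟ suc i
    ... | yes refl | _ = trans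
      (swapped j (suc i) (trans (sym (ℤ.neg-involutive _)) (cong -_ (sym signs))) (adjSwap-inject₁ i)
        (λ r c → cong (M (suc r)) (adjSwap-punchIn-inject₁ i c)))
      (cong (λ t → - laplaceTerm M t) (sym (adjSwap-inject₁ i)))
    ... | no _ | yes refl = trans
      (swapped j (inject₁ i) signs (adjSwap-suc i) (λ r c → cong (M (suc r)) (adjSwap-punchIn-suc i c)))
      (cong (λ t → - laplaceTerm M t) (sym (adjSwap-suc i)))
    ... | no j≢i | no j≢i+1 with i′ , commute ← adjSwap-punchIn i j j≢i j≢i+1 = begin
      signℤ (toℕ j) * (M zero (adjSwap i j) * det (minor j M′))
        ≡⟨ cong₂ (λ x y → signℤ (toℕ j) * (M zero x * y)) fixed (det-cong (λ r c → cong (M (suc r)) (commute c))) ⟩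
      signℤ (toℕ j) * (M zero j * det (λ r c → minor j M r (adjSwap i′ c)))
        ≡⟨ cong (λ y → signℤ (toℕ j) * (M zero j * y)) (det-adjSwapColumns i′ (minor j M)) ⟩
      signℤ (toℕ j) * (M zero j * - det (minor j M))            ≡⟨ pull-neg (signℤ (toℕ j)) (M zero j) (det (minor j M)) ⟩
      - laplaceTerm M j                                          ≡⟨ cong (λ t → - laplaceTerm M t) fixed ⟨
      - laplaceTerm M (adjSwap i j)                              ∎
      where
      fixed = adjSwap-other i j≢i j≢i+1
      pull-neg : ∀ σ x d → σ * (x * - d) ≡ - (σ * (x * d))
      pull-neg = solve-∀

  x≡-x⇒x≡0 : ∀ {x} → x ≡ - x → x ≡ + 0
  x≡-x⇒x≡0 {+ zero} _ = refl

  -- Induction on the distance between the two columns, moving the right one leftwards by adjacent swaps.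
  det-equalColumns-at : ∀ {m} d {M : Mat m} {p q} → suc (toℕ p ℕ.+ d) ≡ toℕ q →
    (∀ r → M r p ≡ M r q) → det M ≡ + 0
  det-equalColumns-at d {M} {p} {suc i} p+d+1≡q Mp≡Mq with d
  ... | zero = x≡-x⇒x≡0 (trans (sym (det-cong unchanged)) (det-adjSwapColumns i M))
    where
    p≡i : p ≡ inject₁ i
    p≡i = toℕ-injective (trans (trans (sym (ℕ.+-identityʳ (toℕ p))) (ℕ.suc-injective p+d+1≡q)) (sym (toℕ-inject₁ i)))
    unchanged : ∀ r c → M r (adjSwap i c) ≡ M r c
    unchanged r c with c Fin.≟ inject₁ i | c Fin.≟ suc i
    ... | yes refl | _ = trans (cong (M r) (adjSwap-inject₁ i)) (sym (trans (cong (M r) (sym p≡i)) (Mp≡Mq r)))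
    ... | no _ | yes refl = trans (cong (M r) (adjSwap-suc i)) (trans (cong (M r) (sym p≡i)) (Mp≡Mq r))
    ... | no c≢i | no c≢i+1 = cong (M r) (adjSwap-other i c≢i c≢i+1)
  ... | suc d′ = begin
    det M                                   ≡⟨ ℤ.neg-involutive (det M) ⟨
    - - det M                               ≡⟨ cong -_ (det-adjSwapColumns i M) ⟨
    - det (λ r c → M r (adjSwap i c))       ≡⟨ cong -_ (det-equalColumns-at d′ (trans p+d′+1≡i (sym (toℕ-inject₁ i))) equal) ⟩
    - + 0                                   ∎
    where
    p+d′+1≡i : suc (toℕ p ℕ.+ d′) ≡ toℕ i
    p+d′+1≡i = trans (sym (ℕ.+-suc (toℕ p) d′)) (ℕ.suc-injective p+d+1≡q)
    p<i : toℕ p ℕ.< toℕ i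
    p<i = ≡.subst (toℕ p ℕ.<_) p+d′+1≡i (ℕ.s≤s (ℕ.m≤m+n (toℕ p) d′))
    p≢i : p ≢ inject₁ i
    p≢i p≡i = ℕ.<⇒≢ p<i (trans (cong toℕ p≡i) (toℕ-inject₁ i))
    p≢i+1 : p ≢ suc i
    p≢i+1 p≡i+1 = ℕ.<⇒≢ (ℕ.m<n⇒m<1+n p<i) (cong toℕ p≡i+1)
    equal : ∀ r → M r (adjSwap i p) ≡ M r (adjSwap i (inject₁ i))
    equal r = trans (cong (M r) (adjSwap-other i p≢i p≢i+1)) (trans (Mp≡Mq r) (cong (M r) (sym (adjSwap-inject₁ i))))

  det-equalColumns : ∀ {m} {M : Mat m} {p q} → p ≢ q → (∀ r → M r p ≡ M r q) → det M ≡ + 0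
  det-equalColumns {p = p} {q} p≢q Mp≡Mq with ℕ.<-cmp (toℕ p) (toℕ q)
  ... | tri< p<q _ _ = det-equalColumns-at _ (proj₂ (ℕ.m≤n⇒∃[o]m+o≡n p<q)) Mp≡Mq
  ... | tri≈ _ p≡q _ = ⊥-elim (p≢q (toℕ-injective p≡q))
  ... | tri> _ _ q<p = det-equalColumns-at _ (proj₂ (ℕ.m≤n⇒∃[o]m+o≡n q<p)) (sym ∘ Mp≡Mq)

  AgreeOffRow : ∀ {m} → Fin m → Mat m → Mat m → Set
  AgreeOffRow q M N = ∀ r c → r ≢ q → M r c ≡ N r c

  record IsAlternatingMultilinear {m} (D : Mat m → ℤ) : Set where
    field
      D-cong : ∀ {M N} → M ≋ N → D M ≡ D N
      D-linear : ∀ q a {M N P} → AgreeOffRow q M P → AgreeOffRow q N P →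
                 (∀ c → P q c ≡ a * M q c + N q c) → D P ≡ a * D M + D N
      D-equalRows : ∀ {M p q} → p ≢ q → (∀ c → M p c ≡ M q c) → D M ≡ + 0

  setRow : ∀ {m} → Mat m → Fin m → (Fin m → ℤ) → Mat m
  setRow M q v r with r Fin.≟ q
  ... | yes _ = v
  ... | no _ = M r

  setRow-≡ : ∀ {m} (M : Mat m) q v c → setRow M q v q c ≡ v c
  setRow-≡ M q v c with q Fin.≟ q
  ... | yes _ = refl
  ... | no q≢q = ⊥-elim (q≢q refl)

  setRow-≢ : ∀ {m} (M : Mat m) {q} v {r} c → r ≢ q → setRow M q v r c ≡ M r c
  setRow-≢ M {q} v {r} c r≢q with r Fin.≟ q
  ... | yes r≡q = ⊥-elim (r≢q r≡q)
  ... | no _ = refl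

  setRow-id : ∀ {m} (M : Mat m) q {v} → (∀ c → v c ≡ M q c) → setRow M q v ≋ M
  setRow-id M q v≡Mq r c with r Fin.≟ q
  ... | yes refl = v≡Mq c
  ... | no _ = refl

  setRow-agreeOffRow-cong : ∀ {m} {p q} {M N : Mat m} {v} → AgreeOffRow p M N → AgreeOffRow p (setRow M q v) (setRow N q v)
  setRow-agreeOffRow-cong {q = q} M∼N r c r≢p with r Fin.≟ q
  ... | yes _ = refl
  ... | no _ = M∼N r c r≢p

  setRows : ∀ {m} → Fin m → Fin m → (Fin m → ℤ) → (Fin m → ℤ) → Mat m → Mat m
  setRows p q u v M = setRow (setRow M p u) q v

  setRows-p : ∀ {m} p q u v (M : Mat m) → p ≢ q → ∀ c → setRows p q u v M p c ≡ u c
  setRows-p p q u v M p≢q c = trans (setRow-≢ _ v c p≢q) (setRow-≡ M p u c)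

  setRows-q : ∀ {m} p q u v (M : Mat m) → ∀ c → setRows p q u v M q c ≡ v c
  setRows-q p q u v M c = setRow-≡ (setRow M p u) q v c

  takeRows : ∀ {m} → ℕ → Mat m → Mat m → Mat m
  takeRows t X Y r with toℕ r ℕ.<? t
  ... | yes _ = Y r
  ... | no _ = X r

  takeRows-none : ∀ {m} (X Y : Mat m) → takeRows 0 X Y ≋ X
  takeRows-none X Y r c with toℕ r ℕ.<? 0
  ... | no _ = refl

  takeRows-all : ∀ {m} (X Y : Mat m) → takeRows m X Y ≋ Y
  takeRows-all {m} X Y r c with toℕ r ℕ.<? m
  ... | yes _ = refl
  ... | no r≮m = ⊥-elim (r≮m (toℕ<n r))

  takeRows-shared : ∀ {m} t {X Y : Mat m} {p} → (∀ c → X p c ≡ Y p c) → ∀ c → takeRows t X Y p c ≡ X p c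
  takeRows-shared t {p = p} Xp≡Yp c with toℕ p ℕ.<? t
  ... | yes _ = sym (Xp≡Yp c)
  ... | no _ = refl

  takeRows-before : ∀ {m} (X Y : Mat m) q → takeRows (toℕ q) X Y q ≡ X q
  takeRows-before X Y q with toℕ q ℕ.<? toℕ q
  ... | yes q<q = ⊥-elim (ℕ.<-irrefl refl q<q)
  ... | no _ = refl

  takeRows-after : ∀ {m} (X Y : Mat m) q → takeRows (suc (toℕ q)) X Y q ≡ Y q
  takeRows-after X Y q with toℕ q ℕ.<? suc (toℕ q)
  ... | yes _ = refl
  ... | no q≮q+1 = ⊥-elim (q≮q+1 (ℕ.n<1+n (toℕ q)))

  takeRows-step : ∀ {m} {X Y : Mat m} q → AgreeOffRow q (takeRows (toℕ q) X Y) (takeRows (suc (toℕ q)) X Y)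
  takeRows-step q r c r≢q with toℕ r ℕ.<? toℕ q | toℕ r ℕ.<? suc (toℕ q)
  ... | yes _ | yes _ = refl
  ... | yes r<q | no r≮q+1 = ⊥-elim (r≮q+1 (ℕ.m<n⇒m<1+n r<q))
  ... | no r≮q | yes r<q+1 = ⊥-elim (r≢q (toℕ-injective (ℕ.≤-antisym (ℕ.≤-pred r<q+1) (ℕ.≮⇒≥ r≮q))))
  ... | no _ | no _ = refl

  agreeOffRow⇒≋ : ∀ {m} {q} {M N : Mat m} → AgreeOffRow q M N → (∀ c → M q c ≡ N q c) → M ≋ N
  agreeOffRow⇒≋ {q = q} M∼N Mq≡Nq r c with r Fin.≟ q
  ... | yes refl = Mq≡Nq c
  ... | no r≢q = M∼N r c r≢q

  agreeOff⇒≡+δ : ∀ {m} (x y : Fin m → ℤ) {j} → (∀ c → c ≢ j → x c ≡ y c) → ∀ c → y c ≡ (y j - x j) * δ j c + x c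
  agreeOff⇒≡+δ x y {j} x≡y c with c Fin.≟ j
  ... | yes refl = trans (cancel (y c) (x c)) (cong (λ d → (y c - x c) * d + x c) (sym (δ-diag c)))
    where
    cancel : ∀ y x → y ≡ (y - x) * + 1 + x
    cancel = solve-∀
  ... | no c≢j = trans (sym (x≡y c c≢j)) (trans (sym (ℤ.+-identityˡ (x c)))
                   (cong (_+ x c) (trans (sym (ℤ.*-zeroʳ (y j - x j))) (cong ((y j - x j) *_) (sym (δ-off (c≢j ∘ sym)))))))

  module AlternatingMultilinear {m} {D : Mat m → ℤ} (isAlt : IsAlternatingMultilinear D) where
    open IsAlternatingMultilinear isAlt public

    D-additive : ∀ q {M N P} → AgreeOffRow q M P → AgreeOffRow q N P →
                 (∀ c → P q c ≡ M q c + N q c) → D P ≡ D M + D N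
    D-additive q {M} M∼P N∼P Pq = trans
      (D-linear q (+ 1) M∼P N∼P (λ c → trans (Pq c) (cong (_+ _) (sym (ℤ.*-identityˡ (M q c))))))
      (cong (_+ _) (ℤ.*-identityˡ (D M)))

    D-zeroRow : ∀ {M} q → (∀ c → M q c ≡ + 0) → D M ≡ + 0
    D-zeroRow {M} q Mq≡0 = identityʳ-unique (D M) (D M)
      (sym (D-additive q (λ _ _ _ → refl) (λ _ _ _ → refl) (λ c → trans (Mq≡0 c) (cong₂ _+_ (sym (Mq≡0 c)) (sym (Mq≡0 c))))))

    D-addRowMultiple : ∀ {M P} {p q} a → p ≢ q → AgreeOffRow q M P →
                       (∀ c → P q c ≡ a * M p c + M q c) → D P ≡ D M
    D-addRowMultiple {M} {P} {p} {q} a p≢q M∼P Pq = begin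
      D P                        ≡⟨ D-linear q a {setRow M q (M p)} (λ r c r≢q → trans (setRow-≢ M _ c r≢q) (M∼P r c r≢q)) M∼P row-q ⟩
      a * D (setRow M q (M p)) + D M ≡⟨ cong (λ x → a * x + D M) (D-equalRows p≢q equal) ⟩
      a * + 0 + D M              ≡⟨ trans (cong (_+ D M) (ℤ.*-zeroʳ a)) (ℤ.+-identityˡ (D M)) ⟩
      D M                        ∎
      where
      row-q : ∀ c → P q c ≡ a * setRow M q (M p) q c + M q c
      row-q c = trans (Pq c) (cong (λ x → a * x + M q c) (sym (setRow-≡ M q (M p) c)))
      equal : ∀ c → setRow M q (M p) p c ≡ setRow M q (M p) q c
      equal c = trans (setRow-≢ M _ c p≢q) (sym (setRow-≡ M q (M p) c))

    D-setRows-antisym : ∀ {p q} (M : Mat m) u v → p ≢ q → D (setRows p q u v M) ≡ - D (setRows p q v u M)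
    D-setRows-antisym {p} {q} M u v p≢q = inverseˡ-unique (D (T u v)) (D (T v u)) (begin
      D (T u v) + D (T v u)                                  ≡⟨ cong₂ _+_ (ℤ.+-identityˡ (D (T u v))) (ℤ.+-identityʳ (D (T v u))) ⟨
      (+ 0 + D (T u v)) + (D (T v u) + + 0)                  ≡⟨ cong₂ (λ x y → x + D (T u v) + (D (T v u) + y)) (T-equal u) (T-equal v) ⟨
      (D (T u u) + D (T u v)) + (D (T v u) + D (T v v))      ≡⟨ cong₂ _+_ (additive-q u u v) (additive-q v u v) ⟨
      D (T u u+v) + D (T v u+v)                              ≡⟨ additive-p u v u+v ⟨
      D (T u+v u+v)                                          ≡⟨ T-equal u+v ⟩
      + 0                                                    ∎)
      where
      T : (Fin m → ℤ) → (Fin m → ℤ) → Mat m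
      T u v = setRows p q u v M
      u+v : Fin m → ℤ
      u+v c = u c + v c
      T-equal : ∀ w → D (T w w) ≡ + 0
      T-equal w = D-equalRows p≢q (λ c → trans (setRows-p p q w w M p≢q c) (sym (setRows-q p q w w M c)))
      additive-p : ∀ u₁ u₂ v → D (T (λ c → u₁ c + u₂ c) v) ≡ D (T u₁ v) + D (T u₂ v)
      additive-p u₁ u₂ v = D-additive p off-p off-p
        (λ c → trans (setRows-p p q _ v M p≢q c) (sym (cong₂ _+_ (setRows-p p q u₁ v M p≢q c) (setRows-p p q u₂ v M p≢q c))))
        where
        off-p : ∀ {u u′} → AgreeOffRow p (T u v) (T u′ v)
        off-p = setRow-agreeOffRow-cong (λ r c r≢p → trans (setRow-≢ M _ c r≢p) (sym (setRow-≢ M _ c r≢p)))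
      additive-q : ∀ u v₁ v₂ → D (T u (λ c → v₁ c + v₂ c)) ≡ D (T u v₁) + D (T u v₂)
      additive-q u v₁ v₂ = D-additive q off-q off-q
        (λ c → trans (setRows-q p q u _ M c) (sym (cong₂ _+_ (setRows-q p q u v₁ M c) (setRows-q p q u v₂ M c))))
        where
        off-q : ∀ {v v′} → AgreeOffRow q (T u v) (T u v′)
        off-q r c r≢q = trans (setRow-≢ _ _ c r≢q) (sym (setRow-≢ _ _ c r≢q))

    D-swapRows : ∀ {M N : Mat m} {p q} → p ≢ q → (∀ r c → r ≢ p → r ≢ q → N r c ≡ M r c) →
                 (∀ c → N p c ≡ M q c) → (∀ c → N q c ≡ M p c) → D N ≡ - D M
    D-swapRows {M} {N} {p} {q} p≢q N≡M-off Np≡Mq Nq≡Mp = begin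
      D N                                    ≡⟨ D-cong N≋swapped ⟩
      D (setRows p q (M q) (M p) M)          ≡⟨ D-setRows-antisym M (M q) (M p) p≢q ⟩
      - D (setRows p q (M p) (M q) M)        ≡⟨ cong -_ (D-cong unchanged) ⟩
      - D M                                  ∎
      where
      N≋swapped : N ≋ setRows p q (M q) (M p) M
      N≋swapped = agreeOffRow⇒≋ (λ r c r≢q → trans (N≡row-p r c r≢q) (sym (setRow-≢ _ _ c r≢q)))
                                (λ c → trans (Nq≡Mp c) (sym (setRows-q p q (M q) (M p) M c)))
        where
        N≡row-p : ∀ r c → r ≢ q → N r c ≡ setRow M p (M q) r c
        N≡row-p r c r≢q with r Fin.≟ p
        ... | yes refl = Np≡Mq c
        ... | no r≢p = N≡M-off r c r≢p r≢q
      unchanged : setRows p q (M p) (M q) M ≋ M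
      unchanged r c = trans
        (setRow-id (setRow M p (M p)) q (λ c → sym (setRow-≢ M _ c (p≢q ∘ sym))) r c)
        (setRow-id M p (λ _ → refl) r c)

    D-linear-Σ : ∀ (M : Mat m) q {t} (a : Fin t → ℤ) (u : Fin t → Fin m → ℤ) →
      D (setRow M q (λ c → sumℤ (λ l → a l * u l c))) ≡ sumℤ (λ l → a l * D (setRow M q (u l)))
    D-linear-Σ M q {zero} a u = D-zeroRow q (setRow-≡ M q _)
    D-linear-Σ M q {suc t} a u = trans
      (D-linear q (a zero) (off (u zero)) (off rest) row-q)
      (cong (_+_ (a zero * D (setRow M q (u zero)))) (D-linear-Σ M q (a ∘ suc) (u ∘ suc)))
      where
      rest : Fin m → ℤ
      rest c = sumℤ (λ l → a (suc l) * u (suc l) c)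
      off : ∀ v {w} → AgreeOffRow q (setRow M q v) (setRow M q w)
      off v r c r≢q = trans (setRow-≢ M v c r≢q) (sym (setRow-≢ M _ c r≢q))
      row-q : ∀ c → setRow M q (λ c → sumℤ (λ l → a l * u l c)) q c ≡ a zero * setRow M q (u zero) q c + setRow M q rest q c
      row-q c = trans (setRow-≡ M q _ c) (sym (cong₂ (λ x y → a zero * x + y) (setRow-≡ M q (u zero) c) (setRow-≡ M q rest c)))

    -- The rows of X are replaced by those of Y one at a time; each replacement adds a multiple of row p = e_j.
    D-clearColumn : ∀ {X Y : Mat m} p j → (∀ c → X p c ≡ δ j c) → (∀ c → Y p c ≡ δ j c) →
                    (∀ r c → c ≢ j → X r c ≡ Y r c) → D X ≡ D Y
    D-clearColumn {X} {Y} p j Xp≡δ Yp≡δ X≡Y-off-j = begin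
      D X                   ≡⟨ D-cong (takeRows-none X Y) ⟨
      D (takeRows 0 X Y)    ≡⟨ invariant m ℕ.≤-refl ⟩
      D (takeRows m X Y)    ≡⟨ D-cong (takeRows-all X Y) ⟩
      D Y                   ∎
      where
      Xp≡Yp : ∀ c → X p c ≡ Y p c
      Xp≡Yp c = trans (Xp≡δ c) (sym (Yp≡δ c))
      step : ∀ q → D (takeRows (toℕ q) X Y) ≡ D (takeRows (suc (toℕ q)) X Y)
      step q with q Fin.≟ p
      ... | yes refl = D-cong (agreeOffRow⇒≋ (takeRows-step q) λ c →
        trans (≡.cong-app (takeRows-before X Y q) c) (trans (Xp≡Yp c) (sym (≡.cong-app (takeRows-after X Y q) c))))
      ... | no q≢p = sym (D-addRowMultiple (Y q j - X q j) (q≢p ∘ sym) (takeRows-step q) row-q)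
        where
        row-q : ∀ c → takeRows (suc (toℕ q)) X Y q c ≡ (Y q j - X q j) * takeRows (toℕ q) X Y p c + takeRows (toℕ q) X Y q c
        row-q c = begin
          takeRows (suc (toℕ q)) X Y q c                       ≡⟨ ≡.cong-app (takeRows-after X Y q) c ⟩
          Y q c                                                ≡⟨ agreeOff⇒≡+δ (X q) (Y q) (λ c c≢j → X≡Y-off-j q c c≢j) c ⟩
          (Y q j - X q j) * δ j c + X q c                      ≡⟨ cong₂ (λ x y → (Y q j - X q j) * x + y)
                                                                    (trans (sym (Xp≡δ c)) (sym (takeRows-shared (toℕ q) Xp≡Yp c)))
                                                                    (sym (≡.cong-app (takeRows-before X Y q) c)) ⟩
          (Y q j - X q j) * takeRows (toℕ q) X Y p c + takeRows (toℕ q) X Y q c ∎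
      invariant : ∀ t → t ℕ.≤ m → D (takeRows 0 X Y) ≡ D (takeRows t X Y)
      invariant zero _ = refl
      invariant (suc t) t<m = trans (invariant t (ℕ.<⇒≤ t<m))
        (≡.subst (λ t → D (takeRows t X Y) ≡ D (takeRows (suc t) X Y)) (toℕ-fromℕ< t<m) (step (Fin.fromℕ< t<m)))

  punchIn-inject₁ : ∀ {k} (j : Fin k) → punchIn (inject₁ j) j ≡ suc j
  punchIn-inject₁ zero = refl
  punchIn-inject₁ (suc j) = cong suc (punchIn-inject₁ j)

  punchIn-suc : ∀ {k} (j : Fin k) → punchIn (suc j) j ≡ inject₁ j
  punchIn-suc zero = refl
  punchIn-suc (suc j) = cong suc (punchIn-suc j)

  punchIn-suc-inject₁ : ∀ {k} {j r : Fin k} → r ≢ j → punchIn (suc j) r ≡ punchIn (inject₁ j) r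
  punchIn-suc-inject₁ {j = zero} {zero} r≢j = ⊥-elim (r≢j refl)
  punchIn-suc-inject₁ {j = zero} {suc r} _ = refl
  punchIn-suc-inject₁ {j = suc j} {zero} _ = refl
  punchIn-suc-inject₁ {j = suc j} {suc r} r≢j = cong suc (punchIn-suc-inject₁ (r≢j ∘ cong suc))

  extend : ∀ {k} → Fin (suc k) → Mat k → Mat (suc k)
  extend j R zero c = δ j c
  extend j R (suc r) c with j Fin.≟ c
  ... | yes _ = + 0
  ... | no j≢c = R r (punchOut j≢c)

  extend-Id : ∀ {k} (j : Fin (suc k)) r c → extend j Id (suc r) c ≡ δ (punchIn j r) c
  extend-Id j r c with j Fin.≟ c
  ... | yes refl = sym (δ-off (punchInᵢ≢i j r))
  ... | no j≢c = trans (sym (δ-punchIn j r (punchOut j≢c))) (cong (δ (punchIn j r)) (punchIn-punchOut j≢c))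

  module _ {k} {D : Mat (suc k) → ℤ} (isAlt : IsAlternatingMultilinear D) where
    open AlternatingMultilinear isAlt

    extend-isAlternatingMultilinear : ∀ j → IsAlternatingMultilinear (λ R → D (extend j R))
    extend-isAlternatingMultilinear j = record
      { D-cong = λ R≋S → D-cong (extend-cong R≋S)
      ; D-linear = λ q a {R} {S} {P} R∼P S∼P Pq → D-linear (suc q) a (extend-off R∼P) (extend-off S∼P) (extend-row {a = a} {R} {S} Pq)
      ; D-equalRows = λ {R} p≢q Rp≡Rq → D-equalRows (p≢q ∘ suc-injective) (extend-equal Rp≡Rq)
      }
      where
      extend-cong : ∀ {R S} → R ≋ S → extend j R ≋ extend j S
      extend-cong R≋S zero c = refl
      extend-cong R≋S (suc r) c with j Fin.≟ c
      ... | yes _ = refl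
      ... | no j≢c = R≋S r (punchOut j≢c)
      extend-off : ∀ {q R P} → AgreeOffRow q R P → AgreeOffRow (suc q) (extend j R) (extend j P)
      extend-off R∼P zero c _ = refl
      extend-off R∼P (suc r) c r≢q with j Fin.≟ c
      ... | yes _ = refl
      ... | no j≢c = R∼P r (punchOut j≢c) (r≢q ∘ cong suc)
      extend-row : ∀ {q a R S P} → (∀ c → P q c ≡ a * R q c + S q c) →
                   ∀ c → extend j P (suc q) c ≡ a * extend j R (suc q) c + extend j S (suc q) c
      extend-row {a = a} Pq c with j Fin.≟ c
      ... | yes _ = sym (trans (ℤ.+-identityʳ (a * + 0)) (ℤ.*-zeroʳ a))
      ... | no j≢c = Pq (punchOut j≢c)
      extend-equal : ∀ {R p q} → (∀ c → R p c ≡ R q c) → ∀ c → extend j R (suc p) c ≡ extend j R (suc q) c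
      extend-equal Rp≡Rq c with j Fin.≟ c
      ... | yes _ = refl
      ... | no j≢c = Rp≡Rq (punchOut j≢c)

    -- Row 0 of extend (suc j) Id is row (suc j) of extend (inject₁ j) Id and vice versa; all other rows agree.
    D-extend-Id : ∀ t {j} → toℕ j ≡ t → D (extend j Id) ≡ signℤ t * D Id
    D-extend-Id zero {zero} refl = trans (D-cong extend-zero) (sym (ℤ.*-identityˡ (D Id)))
      where
      extend-zero : extend zero Id ≋ Id
      extend-zero zero c = refl
      extend-zero (suc r) c = extend-Id zero r c
    D-extend-Id (suc t) {suc j} j+1≡t+1 = begin
      D (extend (suc j) Id)                      ≡⟨ D-swapRows (λ ()) others row-0 row-j ⟩
      - D (extend (inject₁ j) Id)                ≡⟨ cong -_ (D-extend-Id t (trans (toℕ-inject₁ j) (ℕ.suc-injective j+1≡t+1))) ⟩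
      - (signℤ t * D Id)                         ≡⟨ ℤ.neg-distribˡ-* (signℤ t) (D Id) ⟩
      signℤ (suc t) * D Id                       ∎
      where
      row-0 : ∀ c → extend (suc j) Id zero c ≡ extend (inject₁ j) Id (suc j) c
      row-0 c = sym (trans (extend-Id (inject₁ j) j c) (cong (λ t → δ t c) (punchIn-inject₁ j)))
      row-j : ∀ c → extend (suc j) Id (suc j) c ≡ extend (inject₁ j) Id zero c
      row-j c = trans (extend-Id (suc j) j c) (cong (λ t → δ t c) (punchIn-suc j))
      others : ∀ r c → r ≢ zero → r ≢ suc j → extend (suc j) Id r c ≡ extend (inject₁ j) Id r c
      others zero c r≢0 _ = ⊥-elim (r≢0 refl)
      others (suc r) c _ r≢j = trans (extend-Id (suc j) r c)
        (trans (cong (λ t → δ t c) (punchIn-suc-inject₁ (r≢j ∘ cong suc))) (sym (extend-Id (inject₁ j) r c)))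

  -- Linearity in row 0 reduces to first rows e_l; clearing column l below it gives extend l (minor l M), and
  -- R ↦ D (extend l R) is alternating multilinear one size smaller.
  det-characterisation : ∀ {m} {D : Mat m → ℤ} → IsAlternatingMultilinear D → ∀ M → D M ≡ det M * D Id
  det-characterisation {zero} isAlt M = trans (IsAlternatingMultilinear.D-cong isAlt (λ ())) (sym (ℤ.*-identityˡ _))
  det-characterisation {suc k} {D} isAlt M = begin
    D M                                                                  ≡⟨ D-cong (setRow-id M zero row-0) ⟨
    D (setRow M zero (λ c → sumℤ (λ l → M zero l * δ l c)))              ≡⟨ D-linear-Σ M zero (M zero) δ ⟩
    sumℤ (λ l → M zero l * D (setRow M zero (δ l)))                      ≡⟨ Σ-cong (λ l → cong (M zero l *_) (unit-row l)) ⟩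
    sumℤ (λ l → M zero l * (det (minor l M) * (signℤ (toℕ l) * D Id)))
      ≡⟨ Σ-cong (λ l → rearrange (M zero l) (det (minor l M)) (signℤ (toℕ l)) (D Id)) ⟩
    sumℤ (λ l → laplaceTerm M l * D Id)                                  ≡⟨ *-distribʳ-Σ (D Id) (laplaceTerm M) ⟨
    det M * D Id                                                         ∎
    where
    open AlternatingMultilinear isAlt
    row-0 : ∀ c → sumℤ (λ l → M zero l * δ l c) ≡ M zero c
    row-0 c = Σ-δʳ c (M zero)
    rearrange : ∀ x d σ i → x * (d * (σ * i)) ≡ σ * (x * d) * i
    rearrange = solve-∀
    cleared : ∀ l r c → c ≢ l → setRow M zero (δ l) r c ≡ extend l (minor l M) r c
    cleared l zero c _ = setRow-≡ M zero (δ l) c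
    cleared l (suc r) c c≢l with l Fin.≟ c
    ... | yes l≡c = ⊥-elim (c≢l (sym l≡c))
    ... | no l≢c = trans (setRow-≢ M {zero} (δ l) c (λ ())) (cong (M (suc r)) (sym (punchIn-punchOut l≢c)))
    unit-row : ∀ l → D (setRow M zero (δ l)) ≡ det (minor l M) * (signℤ (toℕ l) * D Id)
    unit-row l = begin
      D (setRow M zero (δ l))              ≡⟨ D-clearColumn zero l (setRow-≡ M zero (δ l)) (λ _ → refl) (cleared l) ⟩
      D (extend l (minor l M))             ≡⟨ det-characterisation (extend-isAlternatingMultilinear isAlt l) (minor l M) ⟩
      det (minor l M) * D (extend l Id)    ≡⟨ cong (det (minor l M) *_) (D-extend-Id isAlt (toℕ l) refl) ⟩
      det (minor l M) * (signℤ (toℕ l) * D Id) ∎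

  det∘transpose-isAlternatingMultilinear : ∀ {m} → IsAlternatingMultilinear (λ (M : Mat m) → det (transpose M))
  det∘transpose-isAlternatingMultilinear = record
    { D-cong = λ M≋N → det-cong (λ r c → M≋N c r)
    ; D-linear = λ q a M∼P N∼P Pq → det-columnLinear q a (λ r c → M∼P c r) (λ r c → N∼P c r) Pq
    ; D-equalRows = λ p≢q Mp≡Mq → det-equalColumns p≢q Mp≡Mq
    }

  det-transpose : ∀ {m} (M : Mat m) → det (transpose M) ≡ det M
  det-transpose {m} M = begin
    det (transpose M)          ≡⟨ det-characterisation det∘transpose-isAlternatingMultilinear M ⟩
    det M * det (transpose (Id {m})) ≡⟨ cong (det M *_) (trans (det-cong {M = transpose (Id {m})} {Id} (λ r c → δ-sym c r)) (det-Id {m})) ⟩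
    det M * + 1                ≡⟨ ℤ.*-identityʳ (det M) ⟩
    det M                      ∎

  det-isAlternatingMultilinear : ∀ {m} → IsAlternatingMultilinear (det {m})
  det-isAlternatingMultilinear = record
    { D-cong = det-cong
    ; D-linear = λ q a {M} {N} {P} M∼P N∼P Pq → begin
        det P                                            ≡⟨ det-transpose P ⟨
        det (transpose P)                                ≡⟨ D-linear q a M∼P N∼P Pq ⟩
        a * det (transpose M) + det (transpose N)        ≡⟨ cong₂ (λ x y → a * x + y) (det-transpose M) (det-transpose N) ⟩
        a * det M + det N                                ∎
    ; D-equalRows = λ {M} p≢q Mp≡Mq → trans (sym (det-transpose M)) (D-equalRows p≢q Mp≡Mq)
    }
    where open IsAlternatingMultilinear det∘transpose-isAlternatingMultilinear

  det-⊗ : ∀ {m} (X Y : Mat m) → det (X ⊗ Y) ≡ det X * det Y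
  det-⊗ X Y = begin
    det (X ⊗ Y)        ≡⟨ det-characterisation (⊗Y-isAlternatingMultilinear Y) X ⟩
    det X * det (Id ⊗ Y) ≡⟨ cong (det X *_) (det-cong (λ r c → Σ-δˡ r (λ l → Y l c))) ⟩
    det X * det Y      ∎
    where
    ⊗Y-isAlternatingMultilinear : ∀ {m} (Y : Mat m) → IsAlternatingMultilinear (λ X → det (X ⊗ Y))
    ⊗Y-isAlternatingMultilinear Y = record
      { D-cong = λ X≋X′ → det-cong (λ r c → Σ-cong (λ l → cong (_* Y l c) (X≋X′ r l)))
      ; D-linear = λ q a {M} {N} {P} M∼P N∼P Pq → D-linear q a
          (λ r c r≢q → Σ-cong (λ l → cong (_* Y l c) (M∼P r l r≢q)))
          (λ r c r≢q → Σ-cong (λ l → cong (_* Y l c) (N∼P r l r≢q)))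
          (λ c → begin
            sumℤ (λ l → P q l * Y l c)                                ≡⟨ Σ-cong (λ l → trans (cong (_* Y l c) (Pq l)) (distrib a (M q l) (N q l) (Y l c))) ⟩
            sumℤ (λ l → a * (M q l * Y l c) + N q l * Y l c)          ≡⟨ Σ-distrib-+ (λ l → a * (M q l * Y l c)) (λ l → N q l * Y l c) ⟩
            sumℤ (λ l → a * (M q l * Y l c)) + (N ⊗ Y) q c            ≡⟨ cong (_+ (N ⊗ Y) q c) (*-distribˡ-Σ a (λ l → M q l * Y l c)) ⟨
            a * (M ⊗ Y) q c + (N ⊗ Y) q c                             ∎)
      ; D-equalRows = λ p≢q Mp≡Mq → D-equalRows p≢q (λ c → Σ-cong (λ l → cong (_* Y l c) (Mp≡Mq l)))
      }
      where
      open IsAlternatingMultilinear det-isAlternatingMultilinear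
      distrib : ∀ a x y z → (a * x + y) * z ≡ a * (x * z) + y * z
      distrib = solve-∀

module SumZeroLattice where
  open Determinant
  open import Data.Nat as ℕ using (ℕ; zero; suc)
  import Data.Nat.Properties as ℕ
  open import Data.Fin using (Fin; zero; suc)
  open import Data.Integer using (ℤ; +_; -[1+_]; _+_; _*_; -_; _-_; ∣_∣)
  open import Data.Integer.Tactic.RingSolver using (solve-∀)
  open import Data.Product using (∃; _×_; _,_; proj₁; proj₂)
  open import Relation.Binary.PropositionalEquality using (cong; cong₂; sym; trans)
  open ≡.≡-Reasoning
  open import Algebra.Properties.AbelianGroup ℤ.+-0-abelianGroup using (inverseˡ-unique; x∙y⁻¹≈ε⇒x≈y)
  open Σℤ using (δ; δ-sym; Σ-cong; Σ-distrib-+; *-distribˡ-Σ; *-distribʳ-Σ; -‿distrib-Σ; Σ-comm; Σ-δˡ; Σ-δʳ)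

  combine : ∀ {k n} → (Fin k → ℤ) → (Fin k → Fin n → ℤ) → Fin n → ℤ
  combine a b i = sumℤ (λ j → a j * b j i)

  trace : ∀ {m} → Mat m → ℤ
  trace M = sumℤ (λ i → M i i)

  trace-Id : ∀ m → trace (Id {m}) ≡ + m
  trace-Id zero = refl
  trace-Id (suc m) = cong (_+_ (+ 1)) (trace-Id m)

  trace-⊗-comm : ∀ {m n} (A : Fin m → Fin n → ℤ) (B : Fin n → Fin m → ℤ) → trace (A ⊗ B) ≡ trace (B ⊗ A)
  trace-⊗-comm A B = trans (Σ-comm (λ i l → A i l * B l i)) (Σ-cong (λ l → Σ-cong (λ i → ℤ.*-comm (A i l) (B l i))))

  ⊗-assoc : ∀ {m n p q} (X : Fin m → Fin n → ℤ) (Y : Fin n → Fin p → ℤ) (Z : Fin p → Fin q → ℤ) →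
            ∀ r c → ((X ⊗ Y) ⊗ Z) r c ≡ (X ⊗ (Y ⊗ Z)) r c
  ⊗-assoc X Y Z r c = begin
    sumℤ (λ l → sumℤ (λ j → X r j * Y j l) * Z l c)   ≡⟨ Σ-cong (λ l → *-distribʳ-Σ (Z l c) (λ j → X r j * Y j l)) ⟩
    sumℤ (λ l → sumℤ (λ j → X r j * Y j l * Z l c))   ≡⟨ Σ-comm (λ l j → X r j * Y j l * Z l c) ⟩
    sumℤ (λ j → sumℤ (λ l → X r j * Y j l * Z l c))   ≡⟨ Σ-cong (λ j → Σ-cong (λ l → ℤ.*-assoc (X r j) (Y j l) (Z l c))) ⟩
    sumℤ (λ j → sumℤ (λ l → X r j * (Y j l * Z l c))) ≡⟨ Σ-cong (λ j → *-distribˡ-Σ (X r j) (λ l → Y j l * Z l c)) ⟨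
    sumℤ (λ j → X r j * sumℤ (λ l → Y j l * Z l c))   ∎

  gram-⊗ : ∀ {k m n} (A : Fin k → Fin m → ℤ) (f : Fin m → Fin n → ℤ) →
           ∀ i j → gram (A ⊗ f) i j ≡ (A ⊗ (gram f ⊗ transpose A)) i j
  gram-⊗ A f i j = begin
    sumℤ (λ c → (A ⊗ f) i c * (A ⊗ f) j c)                  ≡⟨ ⊗-assoc A f (transpose (A ⊗ f)) i j ⟩
    (A ⊗ (f ⊗ transpose (A ⊗ f))) i j                       ≡⟨ Σ-cong (λ l → cong (A i l *_) (middle l)) ⟩
    (A ⊗ (gram f ⊗ transpose A)) i j                        ∎
    where
    middle : ∀ l → (f ⊗ transpose (A ⊗ f)) l j ≡ (gram f ⊗ transpose A) l j
    middle l = begin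
      sumℤ (λ c → f l c * (A ⊗ f) j c)                  ≡⟨ Σ-cong (λ c → ℤ.*-comm (f l c) _) ⟩
      sumℤ (λ c → (A ⊗ f) j c * f l c)                  ≡⟨ ⊗-assoc A f (transpose f) j l ⟩
      sumℤ (λ l′ → A j l′ * gram f l′ l)                ≡⟨ Σ-cong (λ l′ → trans (ℤ.*-comm (A j l′) _) (cong (_* A j l′) (gram-sym l′ l))) ⟩
      sumℤ (λ l′ → gram f l l′ * A j l′)                ∎
      where
      gram-sym : ∀ a b → gram f a b ≡ gram f b a
      gram-sym a b = Σ-cong (λ c → ℤ.*-comm (f a c) (f b c))

  unit-square : ∀ {x y} → x * y ≡ + 1 → x * x ≡ + 1
  unit-square {x} {y} xy≡1 with ℕ.m*n≡1⇒m≡1 ∣ x ∣ ∣ y ∣ (trans (sym (ℤ.abs-* x y)) (cong ∣_∣ xy≡1))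
  unit-square {+ 1} _ | refl = refl
  unit-square { -[1+ 0 ]} _ | refl = refl

  standardBasis : ∀ {m} → Fin m → Fin (suc m) → ℤ
  standardBasis i c = δ (suc i) c - δ zero c

  standardBasis-sum : ∀ {m} (i : Fin m) → sumℤ (standardBasis i) ≡ + 0
  standardBasis-sum i = cong (_+_ (- + 1))
    (trans (Σ-cong (λ c → trans (ℤ.+-identityʳ (δ i c)) (sym (ℤ.*-identityʳ (δ i c))))) (Σ-δˡ i (λ _ → + 1)))

  combine-standardBasis-suc : ∀ {m} (a : Fin m → ℤ) c → combine a standardBasis (suc c) ≡ a c
  combine-standardBasis-suc a c = trans (Σ-cong (λ l → cong (a l *_) (ℤ.+-identityʳ (δ l c)))) (Σ-δʳ c a)

  combine-standardBasis-zero : ∀ {m} (a : Fin m → ℤ) → combine a standardBasis zero ≡ - sumℤ a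
  combine-standardBasis-zero a = trans (Σ-cong (λ l → trans (ℤ.*-comm (a l) (- + 1)) (ℤ.-1*i≡-i (a l)))) (sym (-‿distrib-Σ a))

  sumZero⇒combine-standardBasis : ∀ {m} (v : Fin (suc m) → ℤ) → sumℤ v ≡ + 0 → ∀ c → v c ≡ combine (v ∘ suc) standardBasis c
  sumZero⇒combine-standardBasis v Σv≡0 zero = trans (inverseˡ-unique (v zero) _ Σv≡0) (sym (combine-standardBasis-zero (v ∘ suc)))
  sumZero⇒combine-standardBasis v Σv≡0 (suc c) = sym (combine-standardBasis-suc (v ∘ suc) c)

  gram-standardBasis : ∀ {m} (i j : Fin m) → gram standardBasis i j ≡ δ i j + + 1
  gram-standardBasis i j = trans (cong (_+_ (+ 1)) (trans (Σ-cong (λ c → cong₂ _*_ (ℤ.+-identityʳ (δ i c)) (ℤ.+-identityʳ (δ j c))))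
    (trans (Σ-δˡ i (δ j)) (δ-sym j i)))) (ℤ.+-comm (+ 1) (δ i j))

  onesFirstRow : ∀ {m} → Mat (suc m)
  onesFirstRow zero c = + 1
  onesFirstRow (suc r) c = δ (suc r) c

  det-onesFirstRow : ∀ {m} → det (onesFirstRow {m}) ≡ + 1
  det-onesFirstRow {m} = begin
    det U                                ≡⟨ det-transpose U ⟨
    det (transpose U)                    ≡⟨ det-unitRow {M = transpose U} zero Uᵀ-row-0 ⟩
    + 1 * det (minor zero (transpose U)) ≡⟨ ℤ.*-identityˡ _ ⟩
    det (minor zero (transpose U))       ≡⟨ det-cong {M = minor zero (transpose U)} {Id} (λ r c → δ-sym c r) ⟩
    det (Id {m})                         ≡⟨ det-Id {m} ⟩
    + 1                                  ∎
    where
    U = onesFirstRow {m}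
    Uᵀ-row-0 : ∀ c → transpose U zero c ≡ δ zero c
    Uᵀ-row-0 zero = refl
    Uᵀ-row-0 (suc c) = refl

  -- Row 0 of I + J is e₀ + 𝟙: the e₀ part has I + J one size smaller as its minor, and the 𝟙 part is Uᵀ U.
  det-Id+J : ∀ m → det (λ (r c : Fin m) → δ r c + + 1) ≡ + suc m
  det-Id+J zero = refl
  det-Id+J (suc m) = begin
    det Id+J                      ≡⟨ D-additive zero (λ r c → setRow-≢ Id+J (δ zero) c) (λ r c → setRow-≢ Id+J (λ _ → + 1) c) row-0 ⟩
    det e₀-part + det ones-part   ≡⟨ cong₂ _+_ det-e₀-part det-ones-part ⟩
    + suc m + + 1                 ≡⟨ cong +_ (ℕ.+-comm (suc m) 1) ⟩
    + suc (suc m)                 ∎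
    where
    open AlternatingMultilinear det-isAlternatingMultilinear
    U = onesFirstRow {m}
    Id+J e₀-part ones-part : Mat (suc m)
    Id+J r c = δ r c + + 1
    e₀-part = setRow Id+J zero (δ zero)
    ones-part = setRow Id+J zero (λ _ → + 1)
    row-0 : ∀ c → Id+J zero c ≡ e₀-part zero c + ones-part zero c
    row-0 c = sym (cong₂ _+_ (setRow-≡ Id+J zero (δ zero) c) (setRow-≡ Id+J zero (λ _ → + 1) c))
    det-e₀-part : det e₀-part ≡ + suc m
    det-e₀-part = begin
      det e₀-part                          ≡⟨ det-unitRow {M = e₀-part} zero (setRow-≡ Id+J zero (δ zero)) ⟩
      + 1 * det (minor zero e₀-part)       ≡⟨ ℤ.*-identityˡ _ ⟩
      det (minor zero e₀-part)             ≡⟨ det-cong (λ r c → setRow-≢ Id+J {zero} (δ zero) {suc r} (suc c) (λ ())) ⟩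
      det (λ (r c : Fin m) → δ r c + + 1)  ≡⟨ det-Id+J m ⟩
      + suc m                              ∎
    ones-part≋UᵀU : ones-part ≋ (transpose U ⊗ U)
    ones-part≋UᵀU zero c = trans (setRow-≡ Id+J zero (λ _ → + 1) c)
      (sym (cong (_+_ (+ 1)) (Σℤ.Σ-zeros (λ l → U (suc l) zero * U (suc l) c) (λ l → refl))))
    ones-part≋UᵀU (suc r) c = trans (setRow-≢ Id+J {zero} (λ _ → + 1) {suc r} c (λ ())) (trans (ℤ.+-comm (δ (suc r) c) (+ 1))
      (sym (cong (_+_ (+ 1)) (trans (Σ-cong (λ l → cong (_* δ (suc l) c) (δ-sym l r))) (Σ-δˡ r (λ l → δ (suc l) c))))))
    det-ones-part : det ones-part ≡ + 1
    det-ones-part = begin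
      det ones-part                   ≡⟨ det-cong ones-part≋UᵀU ⟩
      det (transpose U ⊗ U)           ≡⟨ det-⊗ (transpose U) U ⟩
      det (transpose U) * det U       ≡⟨ cong₂ _*_ (trans (det-transpose U) (det-onesFirstRow {m})) (det-onesFirstRow {m}) ⟩
      + 1                             ∎

  invertible⇒square : ∀ {k m} (A : Fin k → Fin m → ℤ) (B : Fin m → Fin k → ℤ) →
    (∀ i j → (A ⊗ B) i j ≡ δ i j) → (∀ i j → (B ⊗ A) i j ≡ δ i j) → k ≡ m
  invertible⇒square {k} {m} A B AB≡Id BA≡Id = ℤ.+-injective (begin
    + k             ≡⟨ trace-Id k ⟨
    trace (Id {k})  ≡⟨ Σ-cong (λ i → AB≡Id i i) ⟨
    trace (A ⊗ B)   ≡⟨ trace-⊗-comm A B ⟩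
    trace (B ⊗ A)   ≡⟨ Σ-cong (λ i → BA≡Id i i) ⟩
    trace (Id {m})  ≡⟨ trace-Id m ⟩
    + m             ∎)

  det-gram-unimodular : ∀ {k n} (A B : Mat k) (f : Fin k → Fin n → ℤ) → (∀ i j → (A ⊗ B) i j ≡ δ i j) →
    det (gram (A ⊗ f)) ≡ det (gram f)
  det-gram-unimodular {k} A B f AB≡Id = begin
    det (gram (A ⊗ f))                         ≡⟨ det-cong (gram-⊗ A f) ⟩
    det (A ⊗ (gram f ⊗ transpose A))           ≡⟨ det-⊗ A _ ⟩
    det A * det (gram f ⊗ transpose A)         ≡⟨ cong (det A *_) (det-⊗ (gram f) (transpose A)) ⟩
    det A * (det (gram f) * det (transpose A)) ≡⟨ cong (λ x → det A * (det (gram f) * x)) (det-transpose A) ⟩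
    det A * (det (gram f) * det A)             ≡⟨ rearrange (det A) (det (gram f)) ⟩
    det A * det A * det (gram f)               ≡⟨ cong (_* det (gram f)) (unit-square {det A} {det B} detA*detB≡1) ⟩
    + 1 * det (gram f)                         ≡⟨ ℤ.*-identityˡ (det (gram f)) ⟩
    det (gram f)                               ∎
    where
    rearrange : ∀ a g → a * (g * a) ≡ a * a * g
    rearrange = solve-∀
    detA*detB≡1 : det A * det B ≡ + 1
    detA*detB≡1 = trans (sym (det-⊗ A B)) (trans (det-cong {M = A ⊗ B} {Id} AB≡Id) (det-Id {k}))

  independent-⊗⇒≡Id : ∀ {k n} (b : Fin k → Fin n → ℤ) → (∀ a → (∀ i → combine a b i ≡ + 0) → ∀ j → a j ≡ + 0) →
    (X : Mat k) → (∀ j c → (X ⊗ b) j c ≡ b j c) → ∀ j i → X j i ≡ δ j i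
  independent-⊗⇒≡Id b b-independent X Xb≡b j i =
    sym (x∙y⁻¹≈ε⇒x≈y (δ j i) (X j i) (b-independent (λ i → δ j i - X j i) vanishes i))
    where
    vanishes : ∀ c → combine (λ i → δ j i - X j i) b c ≡ + 0
    vanishes c = begin
      sumℤ (λ i → (δ j i - X j i) * b i c)                     ≡⟨ Σ-cong (λ i → ℤ.*-distribʳ-+ (b i c) (δ j i) (- X j i)) ⟩
      sumℤ (λ i → δ j i * b i c + - X j i * b i c)             ≡⟨ Σ-distrib-+ (λ i → δ j i * b i c) (λ i → - X j i * b i c) ⟩
      sumℤ (λ i → δ j i * b i c) + sumℤ (λ i → - X j i * b i c)
        ≡⟨ cong₂ _+_ (Σ-δˡ j (λ i → b i c))
                     (trans (Σ-cong (λ i → sym (ℤ.neg-distribˡ-* (X j i) (b i c)))) (sym (-‿distrib-Σ (λ i → X j i * b i c)))) ⟩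
      b j c - (X ⊗ b) j c                                      ≡⟨ cong (λ x → b j c - x) (Xb≡b j c) ⟩
      b j c - b j c                                            ≡⟨ ℤ.+-inverseʳ (b j c) ⟩
      + 0                                                      ∎

  det-gram-⊗standardBasis : ∀ {m k} → k ≡ m → (b : Fin k → Fin (suc m) → ℤ) (A : Fin k → Fin m → ℤ) (B : Fin m → Fin k → ℤ) →
    (∀ i j → (A ⊗ B) i j ≡ δ i j) → (∀ j c → b j c ≡ (A ⊗ standardBasis) j c) → det (gram b) ≡ + suc m
  det-gram-⊗standardBasis {m} refl b A B A⊗B≡Id b≡A·f = begin
    det (gram b)                         ≡⟨ det-cong (λ i j → Σ-cong (λ c → cong₂ _*_ (b≡A·f i c) (b≡A·f j c))) ⟩
    det (gram (A ⊗ standardBasis))       ≡⟨ det-gram-unimodular A B standardBasis A⊗B≡Id ⟩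
    det (gram (standardBasis {m}))       ≡⟨ det-cong {m} {N = λ r c → δ r c + + 1} gram-standardBasis ⟩
    det (λ (r c : Fin m) → δ r c + + 1)  ≡⟨ det-Id+J m ⟩
    + suc m                              ∎

  -- A and B express b in the basis e_(i+1) − e₀ and back; the trace and determinant of these mutually inverse matrices
  -- give the rank and the Gram determinant.
  sumZeroLattice-basis : ∀ {m k} (b : Fin k → Fin (suc m) → ℤ) →
    (∀ j → sumℤ (b j) ≡ + 0) →
    (∀ a → (∀ i → combine a b i ≡ + 0) → ∀ j → a j ≡ + 0) →
    (∀ v → sumℤ v ≡ + 0 → ∃ λ a → ∀ i → v i ≡ combine a b i) →
    (k ≡ m) × (det (gram b) ≡ + suc m)
  sumZeroLattice-basis {m} {k} b b-sumZero b-independent b-spans =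
    k≡m , det-gram-⊗standardBasis k≡m b A B A⊗B≡Id b≡A·f
    where
    A : Fin k → Fin m → ℤ
    A j i = b j (suc i)
    B : Fin m → Fin k → ℤ
    B i = proj₁ (b-spans (standardBasis i) (standardBasis-sum i))
    f≡B·b : ∀ i c → standardBasis i c ≡ (B ⊗ b) i c
    f≡B·b i = proj₂ (b-spans (standardBasis i) (standardBasis-sum i))
    b≡A·f : ∀ j c → b j c ≡ (A ⊗ standardBasis) j c
    b≡A·f j = sumZero⇒combine-standardBasis (b j) (b-sumZero j)
    B⊗A≡Id : ∀ i l → (B ⊗ A) i l ≡ δ i l
    B⊗A≡Id i l = trans (sym (f≡B·b i (suc l))) (ℤ.+-identityʳ (δ i l))
    A⊗B≡Id : ∀ j i → (A ⊗ B) j i ≡ δ j i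
    A⊗B≡Id = independent-⊗⇒≡Id b b-independent (A ⊗ B) λ j c → begin
      ((A ⊗ B) ⊗ b) j c              ≡⟨ ⊗-assoc A B b j c ⟩
      (A ⊗ (B ⊗ b)) j c              ≡⟨ Σ-cong (λ l → cong (A j l *_) (f≡B·b l c)) ⟨
      (A ⊗ standardBasis) j c        ≡⟨ b≡A·f j c ⟨
      b j c                          ∎
    k≡m : k ≡ m
    k≡m = invertible⇒square A B A⊗B≡Id B⊗A≡Id

module StackSorting where
  open import Data.Nat using (ℕ; zero; suc; _+_; _<_; _≤_; _<?_; z≤n; s≤s)
  import Data.Nat.Properties as ℕ
  open import Data.List using (List; []; _∷_; _++_; length; map; upTo; applyUpTo)
  open import Data.List.Properties using (++-assoc; ++-identityʳ)
  open import Data.List.Relation.Unary.All as All using (All; []; _∷_)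
  import Data.List.Relation.Unary.All.Properties as All
  open import Data.List.Membership.Propositional using (_∈_)
  open import Data.List.Membership.Propositional.Properties using (∈-∃++; ∈-++⁺ʳ)
  open import Data.List.Relation.Unary.Any using (here)
  open import Data.List.Relation.Binary.Permutation.Propositional
    using (_↭_; ↭-sym; ↭-refl; ↭-trans; ↭-reflexive)
  open import Data.List.Relation.Binary.Permutation.Propositional.Properties
    using (shift; ++⁺ˡ; ++⁺ʳ; drop-mid; ↭-length; All-resp-↭; ∈-resp-↭; ↭-empty-inv)
  open import Data.Product using (∃; _×_; _,_; proj₁; proj₂)
  open import Data.Empty using (⊥-elim)
  open import Relation.Nullary using (yes; no)
  open import Relation.Binary.PropositionalEquality using (cong; cong₂; sym; trans; subst)
  open ≡.≡-Reasoning

  popLess-all : ∀ x st → All (_< x) st → popLess x st ≡ (st , [])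
  popLess-all x [] [] = refl
  popLess-all x (t ∷ st) (t<x ∷ st<x) with t <? x
  ... | yes _ rewrite popLess-all x st st<x = refl
  ... | no t≮x = ⊥-elim (t≮x t<x)

  popLess-++ : ∀ x st → proj₁ (popLess x st) ++ proj₂ (popLess x st) ≡ st
  popLess-++ x [] = refl
  popLess-++ x (t ∷ st) with t <? x
  ... | yes _ = cong (t ∷_) (popLess-++ x st)
  ... | no _ = refl

  popLess-snoc : ∀ x y st → x < y → popLess x (st ++ y ∷ []) ≡ (proj₁ (popLess x st) , proj₂ (popLess x st) ++ y ∷ [])
  popLess-snoc x y [] x<y with y <? x
  ... | yes y<x = ⊥-elim (ℕ.<-asym x<y y<x)
  ... | no _ = refl
  popLess-snoc x y (t ∷ st) x<y with t <? x
  ... | yes _ rewrite popLess-snoc x y st x<y = refl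
  ... | no _ = refl

  popLess-All : ∀ {P : ℕ → Set} x st → All P st → All P (proj₂ (popLess x st))
  popLess-All x [] [] = []
  popLess-All x (t ∷ st) (pt ∷ pst) with t <? x
  ... | yes _ = popLess-All x st pst
  ... | no _ = pt ∷ pst

  stackGo-∷ : ∀ st x R → stackGo st (x ∷ R) ≡ proj₁ (popLess x st) ++ stackGo (x ∷ proj₂ (popLess x st)) R
  stackGo-∷ st x R with popLess x st
  ... | out , st′ = refl

  stackGo-snoc : ∀ y st R → All (_< y) R → stackGo (st ++ y ∷ []) R ≡ stackGo st R ++ y ∷ []
  stackGo-snoc y st [] [] = refl
  stackGo-snoc y st (x ∷ R) (x<y ∷ R<y) = begin
    stackGo (st ++ y ∷ []) (x ∷ R)                              ≡⟨ stackGo-∷ (st ++ y ∷ []) x R ⟩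
    proj₁ (popLess x (st ++ y ∷ [])) ++ stackGo (x ∷ proj₂ (popLess x (st ++ y ∷ []))) R
      ≡⟨ cong (λ p → proj₁ p ++ stackGo (x ∷ proj₂ p) R) (popLess-snoc x y st x<y) ⟩
    out ++ stackGo ((x ∷ st′) ++ y ∷ []) R                      ≡⟨ cong (out ++_) (stackGo-snoc y (x ∷ st′) R R<y) ⟩
    out ++ (stackGo (x ∷ st′) R ++ y ∷ [])                      ≡⟨ ++-assoc out _ _ ⟨
    (out ++ stackGo (x ∷ st′) R) ++ y ∷ []                      ≡⟨ cong (_++ y ∷ []) (stackGo-∷ st x R) ⟨
    stackGo st (x ∷ R) ++ y ∷ []                                ∎
    where
    out = proj₁ (popLess x st)
    st′ = proj₂ (popLess x st)

  -- An entry larger than everything before it empties the stack when it arrives.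
  stackGo-max : ∀ x st L R → All (_< x) st → All (_< x) L → stackGo st (L ++ x ∷ R) ≡ stackGo st L ++ stackGo (x ∷ []) R
  stackGo-max x st [] R st<x [] = trans (stackGo-∷ st x R) (cong (λ p → proj₁ p ++ stackGo (x ∷ proj₂ p) R) (popLess-all x st st<x))
  stackGo-max x st (l ∷ L) R st<x (l<x ∷ L<x) = begin
    stackGo st (l ∷ L ++ x ∷ R)                                 ≡⟨ stackGo-∷ st l (L ++ x ∷ R) ⟩
    out ++ stackGo (l ∷ st′) (L ++ x ∷ R)                       ≡⟨ cong (out ++_) (stackGo-max x (l ∷ st′) L R (l<x ∷ popLess-All l st st<x) L<x) ⟩
    out ++ (stackGo (l ∷ st′) L ++ stackGo (x ∷ []) R)          ≡⟨ ++-assoc out _ _ ⟨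
    (out ++ stackGo (l ∷ st′) L) ++ stackGo (x ∷ []) R          ≡⟨ cong (_++ stackGo (x ∷ []) R) (stackGo-∷ st l L) ⟨
    stackGo st (l ∷ L) ++ stackGo (x ∷ []) R                    ∎
    where
    out = proj₁ (popLess l st)
    st′ = proj₂ (popLess l st)

  s-max : ∀ x L R → All (_< x) L → All (_< x) R → s (L ++ x ∷ R) ≡ s L ++ s R ++ x ∷ []
  s-max x L R L<x R<x = trans (stackGo-max x [] L R [] L<x) (cong (s L ++_) (stackGo-snoc x [] R R<x))

  upFrom : ℕ → ℕ → List ℕ
  upFrom a zero = []
  upFrom a (suc t) = a ∷ upFrom (suc a) t

  stackGo-upFrom : ∀ a t → stackGo (a ∷ []) (upFrom (suc a) t) ≡ upFrom a (suc t)
  stackGo-upFrom a zero = refl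
  stackGo-upFrom a (suc t) = trans (stackGo-∷ (a ∷ []) (suc a) (upFrom (suc (suc a)) t))
    (trans (cong (λ p → proj₁ p ++ stackGo (suc a ∷ proj₂ p) (upFrom (suc (suc a)) t)) (popLess-all (suc a) (a ∷ []) (ℕ.n<1+n a ∷ [])))
      (cong (a ∷_) (stackGo-upFrom (suc a) t)))

  s-upFrom : ∀ a t L → All (_< a) L → s (L ++ upFrom a t) ≡ s L ++ upFrom a t
  s-upFrom a zero L _ = trans (cong s (++-identityʳ L)) (sym (++-identityʳ (s L)))
  s-upFrom a (suc t) L L<a = trans (stackGo-max a [] L (upFrom (suc a) t) [] L<a) (cong (s L ++_) (stackGo-upFrom a t))

  stackGo-↭ : ∀ st xs → stackGo st xs ↭ st ++ xs
  stackGo-↭ st [] = ↭-sym (↭-reflexive (++-identityʳ st))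
  stackGo-↭ st (x ∷ xs) =
    ↭-trans (↭-reflexive (stackGo-∷ st x xs))
    (↭-trans (++⁺ˡ out (stackGo-↭ (x ∷ st′) xs))
    (↭-trans (++⁺ˡ out (↭-sym (shift x st′ xs)))
    (↭-reflexive (trans (sym (++-assoc out st′ (x ∷ xs))) (cong (_++ x ∷ xs) (popLess-++ x st))))))
    where
    out = proj₁ (popLess x st)
    st′ = proj₂ (popLess x st)

  s-↭ : ∀ xs → s xs ↭ xs
  s-↭ = stackGo-↭ []

  iter-↭ : ∀ k π → iter k π ↭ π
  iter-↭ zero π = ↭-refl
  iter-↭ (suc k) π = ↭-trans (s-↭ (iter k π)) (iter-↭ k π)

  upFrom-snoc : ∀ a j → upFrom a (suc j) ≡ upFrom a j ++ (a + j) ∷ []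
  upFrom-snoc a zero = cong (_∷ []) (sym (ℕ.+-identityʳ a))
  upFrom-snoc a (suc j) = cong (a ∷_) (trans (upFrom-snoc (suc a) j) (cong (λ x → upFrom (suc a) j ++ x ∷ []) (sym (ℕ.+-suc a j))))

  upFrom-< : ∀ a j → All (_< a + j) (upFrom a j)
  upFrom-< a zero = []
  upFrom-< a (suc j) = subst (_< a + suc j) (ℕ.+-identityʳ a) (ℕ.+-monoʳ-< a (s≤s z≤n))
    ∷ subst (λ x → All (_< x) (upFrom (suc a) j)) (sym (ℕ.+-suc a j)) (upFrom-< (suc a) j)

  length-upFrom : ∀ a j → length (upFrom a j) ≡ j
  length-upFrom a zero = refl
  length-upFrom a (suc j) = cong suc (length-upFrom (suc a) j)

  nth-++ : ∀ (xs ys : List ℕ) i → nth (xs ++ ys) (length xs + i) ≡ nth ys i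
  nth-++ [] ys i = refl
  nth-++ (x ∷ xs) ys i = nth-++ xs ys i

  nth-upFrom : ∀ a t r → r < t → nth (upFrom a t) r ≡ a + r
  nth-upFrom a (suc t) zero _ = sym (ℕ.+-identityʳ a)
  nth-upFrom a (suc t) (suc r) (s≤s r<t) = trans (nth-upFrom (suc a) t r r<t) (sym (ℕ.+-suc a r))

  -- p = σ (j+2) 1 (j+3) ⋯ (j+t+2) with σ a rearrangement of 2, …, j+1. An Ln1 permutation of length n is at
  -- stage (n − 2, 0), and one pass of s moves stage (j + 1, t) to stage (j, t + 1).
  Stage : ℕ → ℕ → List ℕ → Set
  Stage j t p = ∃ λ σ → σ ↭ upFrom 2 j × p ≡ σ ++ (2 + j) ∷ 1 ∷ upFrom (3 + j) t

  stage-step : ∀ {j t p} → Stage (suc j) t p → Stage j (suc t) (s p)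
  stage-step {j} {t} (σ , σ↭ , refl)
    -- split σ = L x R at its largest entry x = j + 2
    with L , R , refl ← ∈-∃++ (∈-resp-↭ (↭-sym σ↭) (subst (2 + j ∈_) (sym (upFrom-snoc 2 j)) (∈-++⁺ʳ (upFrom 2 j) (here refl))))
    = s L ++ s R , sLR↭ , sorted
    where
    x = 2 + j
    LR↭ : L ++ R ↭ upFrom 2 j
    LR↭ = ↭-trans (drop-mid L (upFrom 2 j) {R} {[]} (↭-trans σ↭ (↭-reflexive (upFrom-snoc 2 j))))
            (↭-reflexive (++-identityʳ (upFrom 2 j)))
    LR<x : All (_< x) (L ++ R)
    LR<x = All-resp-↭ (↭-sym LR↭) (upFrom-< 2 j)
    L<x : All (_< x) L
    L<x = All.++⁻ˡ L LR<x
    R<x : All (_< x) R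
    R<x = All.++⁻ʳ L LR<x
    sLR↭ : s L ++ s R ↭ upFrom 2 j
    sLR↭ = ↭-trans (↭-trans (++⁺ʳ (s R) (s-↭ L)) (++⁺ˡ L (s-↭ R))) LR↭
    weaken : ∀ {a b xs} → All (_< a) xs → a ≤ b → All (_< b) xs
    weaken xs<a a≤b = All.map (λ y<a → ℕ.<-≤-trans y<a a≤b) xs<a
    σ<x+1 : All (_< 3 + j) (L ++ x ∷ R)
    σ<x+1 = All.++⁺ (weaken L<x (ℕ.n≤1+n x)) (ℕ.n<1+n x ∷ weaken R<x (ℕ.n≤1+n x))
    sorted : s ((L ++ x ∷ R) ++ (3 + j) ∷ 1 ∷ upFrom (4 + j) t) ≡ (s L ++ s R) ++ x ∷ 1 ∷ upFrom (3 + j) (suc t)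
    sorted = begin
      s ((L ++ x ∷ R) ++ (3 + j) ∷ 1 ∷ upFrom (4 + j) t)       ≡⟨ cong s (++-assoc (L ++ x ∷ R) ((3 + j) ∷ 1 ∷ []) (upFrom (4 + j) t)) ⟨
      s (((L ++ x ∷ R) ++ (3 + j) ∷ 1 ∷ []) ++ upFrom (4 + j) t)
        ≡⟨ s-upFrom (4 + j) t _ (All.++⁺ (weaken σ<x+1 (ℕ.n≤1+n (3 + j))) (ℕ.n<1+n (3 + j) ∷ s≤s (s≤s z≤n) ∷ [])) ⟩
      s ((L ++ x ∷ R) ++ (3 + j) ∷ 1 ∷ []) ++ upFrom (4 + j) t
        ≡⟨ cong (_++ upFrom (4 + j) t) (s-max (3 + j) (L ++ x ∷ R) (1 ∷ []) σ<x+1 (s≤s (s≤s z≤n) ∷ [])) ⟩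
      (s (L ++ x ∷ R) ++ 1 ∷ (3 + j) ∷ []) ++ upFrom (4 + j) t ≡⟨ cong (λ y → (y ++ 1 ∷ (3 + j) ∷ []) ++ upFrom (4 + j) t) (s-max x L R L<x R<x) ⟩
      ((s L ++ s R ++ x ∷ []) ++ 1 ∷ (3 + j) ∷ []) ++ upFrom (4 + j) t ≡⟨ reassociate (s L) (s R) ⟩
      (s L ++ s R) ++ x ∷ 1 ∷ upFrom (3 + j) (suc t)           ∎
      where
      reassociate : ∀ A B → ((A ++ B ++ x ∷ []) ++ 1 ∷ (3 + j) ∷ []) ++ upFrom (4 + j) t ≡ (A ++ B) ++ x ∷ 1 ∷ (3 + j) ∷ upFrom (4 + j) t
      reassociate [] [] = refl
      reassociate [] (b ∷ B) = cong (b ∷_) (reassociate [] B)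
      reassociate (a ∷ A) B = cong (a ∷_) (reassociate A B)

  stage-last : ∀ {t p} → Stage 0 t p → s p ≡ upFrom 1 (2 + t)
  stage-last {t} (σ , σ↭ , refl) with refl ← ↭-empty-inv σ↭ =
    s-upFrom 3 t (2 ∷ 1 ∷ []) (s≤s (s≤s (s≤s z≤n)) ∷ s≤s (s≤s z≤n) ∷ [])

  stage-iter : ∀ {j₀ π} → Stage j₀ 0 π → ∀ o j → o + j ≡ j₀ → Stage j o (iter o π)
  stage-iter π₀ zero j refl = π₀
  stage-iter π₀ (suc o) j o+1+j≡j₀ = stage-step (stage-iter π₀ o (suc j) (trans (ℕ.+-suc o j) o+1+j≡j₀))

  stage-sorted : ∀ {j₀ π} → Stage j₀ 0 π → iter (suc j₀) π ≡ upFrom 1 (2 + j₀)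
  stage-sorted {j₀} {π} π₀ = stage-last (stage-iter π₀ j₀ 0 (ℕ.+-identityʳ j₀))

  stage-one : ∀ {j t p} → Stage j t p → nth p (suc j) ≡ 1
  stage-one {j} {t} (σ , σ↭ , refl) with refl ← trans (↭-length σ↭) (length-upFrom 2 j) =
    trans (cong (nth (σ ++ (2 + length σ) ∷ 1 ∷ upFrom (3 + length σ) t)) (ℕ.+-comm 1 (length σ)))
          (nth-++ σ _ 1)

  stage-tail : ∀ {j t p} → Stage j t p → ∀ r → r < t → nth p (2 + j + r) ≡ 3 + j + r
  stage-tail {j} {t} (σ , σ↭ , refl) r r<t with refl ← trans (↭-length σ↭) (length-upFrom 2 j) =
    trans (cong (nth (σ ++ (2 + length σ) ∷ 1 ∷ upFrom (3 + length σ) t)) (trans (cong (_+ r) (ℕ.+-comm 2 (length σ))) (ℕ.+-assoc (length σ) 2 r)))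
          (trans (nth-++ σ _ (2 + r)) (nth-upFrom (3 + length σ) t r r<t))

  map-suc-applyUpTo : ∀ (f : ℕ → ℕ) a t → (∀ i → f i ≡ a + i) → map suc (applyUpTo f t) ≡ upFrom (suc a) t
  map-suc-applyUpTo f a zero _ = refl
  map-suc-applyUpTo f a (suc t) f≗a+ = cong₂ _∷_ (cong suc (trans (f≗a+ 0) (ℕ.+-identityʳ a)))
    (map-suc-applyUpTo (λ i → f (suc i)) (suc a) t (λ i → trans (f≗a+ (suc i)) (ℕ.+-suc a i)))

  1⋯n≡upFrom : ∀ n → map suc (upTo n) ≡ upFrom 1 n
  1⋯n≡upFrom n = map-suc-applyUpTo (λ i → i) 0 n (λ _ → refl)

  perm-length : ∀ {n π} → IsPerm n π → length π ≡ n
  perm-length {n} π↭ = trans (↭-length π↭) (trans (cong length (1⋯n≡upFrom n)) (length-upFrom 1 n))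

  ln1-stage : ∀ {j₀ π} → IsPerm (2 + j₀) π → IsLn1 (2 + j₀) π → Stage j₀ 0 π
  ln1-stage {j₀} π↭ (xs , refl) = xs , xs↭ , refl
    where
    n = 2 + j₀
    drop-1 : (xs ++ n ∷ []) ++ 1 ∷ [] ↭ [] ++ 1 ∷ (upFrom 2 j₀ ++ n ∷ [])
    drop-1 = ↭-trans (↭-reflexive (++-assoc xs (n ∷ []) (1 ∷ [])))
               (↭-trans π↭ (↭-reflexive (trans (1⋯n≡upFrom n) (cong (1 ∷_) (upFrom-snoc 2 j₀)))))
    drop-n : xs ++ n ∷ [] ↭ upFrom 2 j₀ ++ n ∷ []
    drop-n = ↭-trans (↭-reflexive (sym (++-identityʳ _))) (drop-mid (xs ++ n ∷ []) [] drop-1)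
    xs↭ : xs ↭ upFrom 2 j₀
    xs↭ = ↭-trans (↭-reflexive (sym (++-identityʳ xs))) (↭-trans (drop-mid xs (upFrom 2 j₀) {[]} {[]} drop-n) (↭-reflexive (++-identityʳ _)))

module LinearSpan where
  open import Data.Nat as ℕ using (z≤n; s≤s)
  import Data.Nat.Properties as ℕ
  open import Data.Fin using (Fin; zero; suc; toℕ; fromℕ<)
  open import Data.Fin.Properties using (toℕ-fromℕ<; toℕ-injective; toℕ<n)
  open import Data.Rational using (ℚ; 0ℚ; _+_; _*_; -_; 1/_; ≢-nonZero)
  open import Data.Rational.Solver using (module +-*-Solver)
  open import Data.Product using (Σ; _,_)
  open import Data.Empty using (⊥-elim)
  open import Relation.Nullary using (yes; no)
  open import Relation.Binary.PropositionalEquality using (cong; cong₂; sym; trans; subst)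
  open ≡.≡-Reasoning
  open Σℚ using (δ; Σ-cong; Σ-distrib-+; *-distribˡ-Σ; Σ-comm; Σ-zeros; Σ-δˡ)

  InSpan : ∀ {N n} → (Fin N → Fin n → ℚ) → (Fin n → ℚ) → Set
  InSpan {N} u x = Σ (Fin N → ℚ) λ c → ∀ i → x i ≡ sumℚ (λ k → c k * u k i)

  module _ {N n} (u : Fin N → Fin n → ℚ) where

    InSpan-zero : InSpan u (λ _ → 0ℚ)
    InSpan-zero = (λ _ → 0ℚ) , λ i → sym (Σ-zeros (λ k → 0ℚ * u k i) (λ k → ℚ.*-zeroˡ (u k i)))

    InSpan-cong : ∀ {x y} → (∀ i → x i ≡ y i) → InSpan u x → InSpan u y
    InSpan-cong x≗y (c , x≡) = c , λ i → trans (sym (x≗y i)) (x≡ i)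

    InSpan-+* : ∀ {x y} → InSpan u x → InSpan u y → ∀ a → InSpan u (λ i → x i + a * y i)
    InSpan-+* {x} {y} (c , x≡) (c′ , y≡) a = (λ k → c k + a * c′ k) , λ i → begin
      x i + a * y i                                                     ≡⟨ cong₂ (λ p q → p + a * q) (x≡ i) (y≡ i) ⟩
      sumℚ (λ k → c k * u k i) + a * sumℚ (λ k → c′ k * u k i)         ≡⟨ cong (_+_ (sumℚ (λ k → c k * u k i))) (*-distribˡ-Σ a (λ k → c′ k * u k i)) ⟩
      sumℚ (λ k → c k * u k i) + sumℚ (λ k → a * (c′ k * u k i))       ≡⟨ Σ-distrib-+ (λ k → c k * u k i) (λ k → a * (c′ k * u k i)) ⟨
      sumℚ (λ k → c k * u k i + a * (c′ k * u k i))                    ≡⟨ Σ-cong (λ k → distrib (c k) a (c′ k) (u k i)) ⟩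
      sumℚ (λ k → (c k + a * c′ k) * u k i)                            ∎
      where
      open +-*-Solver
      distrib : ∀ c a c′ d → c * d + a * (c′ * d) ≡ (c + a * c′) * d
      distrib = solve 4 (λ c a c′ d → c :* d :+ a :* (c′ :* d) := (c :+ a :* c′) :* d) refl

    InSpan-generator : ∀ k → InSpan u (u k)
    InSpan-generator k = δ k , λ i → sym (Σ-δˡ k (λ l → u l i))

    InSpan-sumZero : (∀ k → sumℚ (u k) ≡ 0ℚ) → ∀ {x} → InSpan u x → sumℚ x ≡ 0ℚ
    InSpan-sumZero Σu≡0 {x} (c , x≡) = begin
      sumℚ x                                   ≡⟨ Σ-cong x≡ ⟩
      sumℚ (λ i → sumℚ (λ k → c k * u k i))    ≡⟨ Σ-comm (λ i k → c k * u k i) ⟩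
      sumℚ (λ k → sumℚ (λ i → c k * u k i))    ≡⟨ Σ-cong (λ k → *-distribˡ-Σ (c k) (u k)) ⟨
      sumℚ (λ k → c k * sumℚ (u k))            ≡⟨ Σ-zeros _ (λ k → trans (cong (c k *_) (Σu≡0 k)) (ℚ.*-zeroʳ (c k))) ⟩
      0ℚ                                       ∎

  record Pivot {N n} (u : Fin N → Fin n → ℚ) (p : Fin n) : Set where
    field
      vector : Fin n → ℚ
      inSpan : InSpan u vector
      nonzero : vector p ≢ 0ℚ
      vanishes-after : ∀ i → toℕ p ℕ.< toℕ i → vector i ≡ 0ℚ

  -- Elimination from the last nonzero entry of v backwards, using the pivot vectors.
  pivots⇒sumZero⊆span : ∀ {N n} (u : Fin N → Fin n → ℚ) → (∀ k → sumℚ (u k) ≡ 0ℚ) →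
    (∀ (p : Fin n) → 0 ℕ.< toℕ p → Pivot u p) → ∀ v → sumℚ v ≡ 0ℚ → InSpan u v
  pivots⇒sumZero⊆span {n = zero} u _ _ v _ = InSpan-cong u (λ ()) (InSpan-zero u)
  pivots⇒sumZero⊆span {n = suc n} u Σu≡0 pivot v Σv≡0 =
    eliminate n (ℕ.n<1+n n) v (λ i n<i → ⊥-elim (ℕ.<⇒≱ (toℕ<n i) n<i)) Σv≡0
    where
    eliminate : ∀ t → t ℕ.< suc n → ∀ v → (∀ i → t ℕ.< toℕ i → v i ≡ 0ℚ) → sumℚ v ≡ 0ℚ → InSpan u v
    eliminate zero _ v v≡0 Σv≡0 = InSpan-cong u (λ i → sym (vanishes i)) (InSpan-zero u)
      where
      vanishes : ∀ i → v i ≡ 0ℚ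
      vanishes zero = trans (sym (ℚ.+-identityʳ (v zero)))
        (trans (cong (_+_ (v zero)) (sym (Σ-zeros (v ∘ suc) (λ i → v≡0 (suc i) (s≤s z≤n))))) Σv≡0)
      vanishes (suc i) = v≡0 (suc i) (s≤s z≤n)
    eliminate (suc t) t+1<n v v≡0 Σv≡0 = InSpan-cong u (λ i → sym (restore (v i) β (w i))) (InSpan-+* u v′-span w-span (- β))
      where
      p : Fin (suc n)
      p = fromℕ< t+1<n
      p≡t+1 : toℕ p ≡ suc t
      p≡t+1 = toℕ-fromℕ< t+1<n
      open Pivot (pivot p (subst (0 ℕ.<_) (sym p≡t+1) (s≤s z≤n)))
        renaming (vector to w; inSpan to w-span; nonzero to wp≢0; vanishes-after to w≡0)
      β : ℚ
      β = - v p * (1/ w p) {{≢-nonZero wp≢0}}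
      βw≡-vp : β * w p ≡ - v p
      βw≡-vp = trans (ℚ.*-assoc (- v p) _ (w p)) (trans (cong (- v p *_) (ℚ.*-inverseˡ (w p) {{≢-nonZero wp≢0}})) (ℚ.*-identityʳ (- v p)))
      v′ : Fin (suc n) → ℚ
      v′ i = v i + β * w i
      v′≡0 : ∀ i → t ℕ.< toℕ i → v′ i ≡ 0ℚ
      v′≡0 i t<i with toℕ i ℕ.≟ suc t
      ... | yes i≡t+1 rewrite toℕ-injective {i = i} {p} (trans i≡t+1 (sym p≡t+1)) =
        trans (cong (_+_ (v p)) βw≡-vp) (ℚ.+-inverseʳ (v p))
      ... | no i≢t+1 = trans (cong₂ (λ x y → x + β * y) (v≡0 i t+1<i) (w≡0 i (subst (ℕ._< toℕ i) (sym p≡t+1) t+1<i)))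
                            (trans (cong (_+_ 0ℚ) (ℚ.*-zeroʳ β)) (ℚ.+-identityʳ 0ℚ))
        where
        t+1<i : suc t ℕ.< toℕ i
        t+1<i = ℕ.≤∧≢⇒< t<i (i≢t+1 ∘ sym)
      Σv′≡0 : sumℚ v′ ≡ 0ℚ
      Σv′≡0 = begin
        sumℚ v′                     ≡⟨ Σ-distrib-+ v (λ i → β * w i) ⟩
        sumℚ v + sumℚ (λ i → β * w i) ≡⟨ cong₂ _+_ Σv≡0 (trans (sym (*-distribˡ-Σ β w)) (cong (β *_) (InSpan-sumZero u Σu≡0 w-span))) ⟩
        0ℚ + β * 0ℚ                 ≡⟨ trans (cong (_+_ 0ℚ) (ℚ.*-zeroʳ β)) (ℚ.+-identityʳ 0ℚ) ⟩
        0ℚ                          ∎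
      v′-span : InSpan u v′
      v′-span = eliminate t (ℕ.<-trans (ℕ.n<1+n t) t+1<n) v′ v′≡0 Σv′≡0
      restore : ∀ x b y → x ≡ (x + b * y) + (- b) * y
      restore = solve 3 (λ x b y → x := (x :+ b :* y) :+ (:- b) :* y) refl
        where open +-*-Solver

module AffineSpan where
  open StackSorting
  open LinearSpan
  open import Data.Nat as ℕ using (ℕ; zero; suc; s≤s)
  import Data.Nat.Properties as ℕ
  open import Data.Fin using (Fin; zero; suc; toℕ; fromℕ<)
  open import Data.Fin.Properties using (toℕ-fromℕ<; toℕ<n)
  open import Data.Integer as ℤ using (ℤ; +_; -[1+_])
  open import Data.Integer.Tactic.RingSolver using (solve-∀)
  open import Data.Rational using (ℚ; mkℚ; 0ℚ; _+_; _*_; -_)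
  import Data.Nat.Coprimality as Coprimality
  open import Data.List using (List; []; _∷_; length)
  open import Data.Nat.ListAction using (sum)
  open import Data.Nat.ListAction.Properties using (sum-↭)
  open import Data.List.Relation.Binary.Permutation.Propositional.Properties using (↭-length)
  open import Data.Product using (_,_)
  open import Relation.Binary.PropositionalEquality using (cong; cong₂; sym; trans; subst)
  open ≡.≡-Reasoning

  -- z / 1 in lowest terms, stated as a record value so that it computes.
  toℚ-mkℚ : ∀ z → toℚ z ≡ mkℚ z 0 (Coprimality.sym (Coprimality.1-coprimeTo ℤ.∣ z ∣))
  toℚ-mkℚ (+ n) = ℚ.normalize-coprime {n} {0} (Coprimality.sym (Coprimality.1-coprimeTo n))
  toℚ-mkℚ -[1+ n ] = cong -_ (ℚ.normalize-coprime {suc n} {0} (Coprimality.sym (Coprimality.1-coprimeTo (suc n))))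

  toℚ-+ : ∀ a b → toℚ (a ℤ.+ b) ≡ toℚ a + toℚ b
  toℚ-+ a b = sym (trans (cong₂ _+_ (toℚ-mkℚ a) (toℚ-mkℚ b)) (cong toℚ (cong₂ ℤ._+_ (ℤ.*-identityʳ a) (ℤ.*-identityʳ b))))

  toℚ-* : ∀ a b → toℚ (a ℤ.* b) ≡ toℚ a * toℚ b
  toℚ-* a b = sym (cong₂ _*_ (toℚ-mkℚ a) (toℚ-mkℚ b))

  toℚ-injective : ∀ {a b} → toℚ a ≡ toℚ b → a ≡ b
  toℚ-injective {a} {b} e = cong ℚ.numerator (trans (sym (toℚ-mkℚ a)) (trans e (toℚ-mkℚ b)))

  toℚ-sum : ∀ {n} (v : Fin n → ℤ) → sumℚ (λ i → toℚ (v i)) ≡ toℚ (sumℤ v)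
  toℚ-sum {zero} v = refl
  toℚ-sum {suc n} v = trans (cong (_+_ (toℚ (v zero))) (toℚ-sum (v ∘ suc))) (sym (toℚ-+ (v zero) (sumℤ (v ∘ suc))))

  Δ : (n : ℕ) → List ℕ → ℕ → Fin n → ℚ
  Δ n π k i = toℚ (point n (iter k π) i ℤ.- point n π i)

  sum-point : ∀ p → sumℤ (point (length p) p) ≡ + sum p
  sum-point [] = refl
  sum-point (x ∷ p) = cong (ℤ._+_ (+ x)) (sum-point p)

  sum-Δ : ∀ {n π} → length π ≡ n → ∀ k → sumℚ (Δ n π k) ≡ 0ℚ
  sum-Δ {n} {π} refl k = begin
    sumℚ (Δ n π k)                                                   ≡⟨ toℚ-sum (λ i → point n (iter k π) i ℤ.- point n π i) ⟩
    toℚ (sumℤ (λ i → point n (iter k π) i ℤ.- point n π i))          ≡⟨ cong toℚ (Σℤ.Σ-distrib-+ (point n (iter k π)) _) ⟩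
    toℚ (sumℤ (point n (iter k π)) ℤ.+ sumℤ (λ i → ℤ.- point n π i)) ≡⟨ cong toℚ (cong₂ ℤ._+_ same-sum (sym (Σℤ.-‿distrib-Σ (point n π)))) ⟩
    toℚ (sumℤ (point n π) ℤ.- sumℤ (point n π))                      ≡⟨ cong toℚ (ℤ.+-inverseʳ (sumℤ (point n π))) ⟩
    0ℚ                                                               ∎
    where
    same-sum : sumℤ (point n (iter k π)) ≡ sumℤ (point n π)
    same-sum with length (iter k π) | ↭-length (iter-↭ k π) | sum-point (iter k π)
    ... | _ | refl | Σiter = trans Σiter (trans (cong +_ (sum-↭ (iter-↭ k π))) (sym (sum-point π)))

  InDir⇒sumZero : ∀ {n π} → length π ≡ n → ∀ v → InDir n π v → sumℤ v ≡ + 0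
  InDir⇒sumZero {n} {π} length-π v (N , span) =
    toℚ-injective (trans (sym (toℚ-sum v)) (InSpan-sumZero (λ (k : Fin N) → Δ n π (toℕ k)) (λ k → sum-Δ {π = π} length-π (toℕ k)) span))

  module _ {j₀ π} (length-π : length π ≡ 2 ℕ.+ j₀) (π₀ : Stage j₀ 0 π) where
    private
      n = 2 ℕ.+ j₀
      u : Fin n → Fin n → ℚ
      u k = Δ n π (toℕ k)

    Δ-span : ∀ o → o ℕ.< n → InSpan u (Δ n π o)
    Δ-span o o<n = InSpan-cong u (λ i → cong (λ k → Δ n π k i) (toℕ-fromℕ< o<n)) (InSpan-generator u (fromℕ< o<n))

    -- The pivot is s^o(π) − e, with e = s^(j₀+1)(π): by stage-one and stage-tail it is 1 − (j + 2) at position j + 1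
    -- and zero beyond.
    pivot-at : ∀ j o → o ℕ.+ j ≡ j₀ → ∀ p → toℕ p ≡ suc j → Pivot u p
    pivot-at j o o+j≡j₀ p p≡j+1 = record
      { vector = w
      ; inSpan = InSpan-+* u (Δ-span o o<n) (Δ-span (suc j₀) (ℕ.n<1+n (suc j₀))) (toℚ -[1+ 0 ])
      ; nonzero = λ wp≡0 → -[1+j]≢0 (toℚ-injective (trans (sym w-at-pivot) wp≡0))
      ; vanishes-after = vanishes-after
      }
      where
      stage-o : Stage j o (iter o π)
      stage-o = stage-iter π₀ o j o+j≡j₀
      o<n : o ℕ.< n
      o<n = s≤s (ℕ.m≤n⇒m≤1+n (subst (o ℕ.≤_) o+j≡j₀ (ℕ.m≤m+n o j)))
      w : Fin n → ℚ
      w i = Δ n π o i + toℚ -[1+ 0 ] * Δ n π (suc j₀) i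
      w≡iterate-sorted : ∀ i → w i ≡ toℚ (point n (iter o π) i ℤ.- point n (upFrom 1 n) i)
      w≡iterate-sorted i = begin
        toℚ (a ℤ.- b) + toℚ -[1+ 0 ] * toℚ (c ℤ.- b)  ≡⟨ cong (_+_ (toℚ (a ℤ.- b))) (toℚ-* -[1+ 0 ] (c ℤ.- b)) ⟨
        toℚ (a ℤ.- b) + toℚ (-[1+ 0 ] ℤ.* (c ℤ.- b))  ≡⟨ toℚ-+ (a ℤ.- b) _ ⟨
        toℚ ((a ℤ.- b) ℤ.+ -[1+ 0 ] ℤ.* (c ℤ.- b))   ≡⟨ cong toℚ (cancel a b c) ⟩
        toℚ (a ℤ.- c)                                 ≡⟨ cong (λ e → toℚ (a ℤ.- point n e i)) (stage-sorted π₀) ⟩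
        toℚ (a ℤ.- point n (upFrom 1 n) i)            ∎
        where
        a = point n (iter o π) i
        b = point n π i
        c = point n (iter (suc j₀) π) i
        cancel : ∀ a b c → (a ℤ.- b) ℤ.+ -[1+ 0 ] ℤ.* (c ℤ.- b) ≡ a ℤ.- c
        cancel = solve-∀
      w-at-pivot : w p ≡ toℚ -[1+ j ]
      w-at-pivot = trans (w≡iterate-sorted p) (cong toℚ (cong₂ (λ x y → + x ℤ.- + y)
        (trans (cong (nth (iter o π)) p≡j+1) (stage-one stage-o))
        (trans (cong (nth (upFrom 1 n)) p≡j+1) (nth-upFrom 1 n (suc j) (subst (ℕ._< n) p≡j+1 (toℕ<n p))))))
      -[1+j]≢0 : -[1+ j ] ≢ + 0
      -[1+j]≢0 ()
      vanishes-after : ∀ i → toℕ p ℕ.< toℕ i → w i ≡ 0ℚ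
      vanishes-after i p<i with r , j+2+r≡i ← ℕ.m≤n⇒∃[o]m+o≡n (subst (ℕ._< toℕ i) p≡j+1 p<i) =
        trans (w≡iterate-sorted i) (cong toℚ (trans (cong₂ (λ x y → + x ℤ.- + y) iterate sorted) (ℤ.+-inverseʳ (+ (3 ℕ.+ j ℕ.+ r)))))
        where
        r<o : r ℕ.< o
        r<o = ℕ.+-cancelˡ-< (2 ℕ.+ j) r o (subst (ℕ._< 2 ℕ.+ j ℕ.+ o) (sym j+2+r≡i)
                (subst (toℕ i ℕ.<_) (cong (2 ℕ.+_) (sym (trans (ℕ.+-comm j o) o+j≡j₀))) (toℕ<n i)))
        iterate : nth (iter o π) (toℕ i) ≡ 3 ℕ.+ j ℕ.+ r
        iterate = trans (cong (nth (iter o π)) (sym j+2+r≡i)) (stage-tail stage-o r r<o)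
        sorted : nth (upFrom 1 n) (toℕ i) ≡ 3 ℕ.+ j ℕ.+ r
        sorted = trans (cong (nth (upFrom 1 n)) (sym j+2+r≡i)) (nth-upFrom 1 n (2 ℕ.+ j ℕ.+ r) (subst (ℕ._< n) (sym j+2+r≡i) (toℕ<n i)))

    pivot : ∀ p → 0 ℕ.< toℕ p → Pivot u p
    pivot p 0<p with toℕ p in p≡t | toℕ<n p
    pivot p () | zero | _
    ... | suc j | s≤s j<j₀+1 = pivot-at j (j₀ ℕ.∸ j) (ℕ.m∸n+n≡m (ℕ.≤-pred j<j₀+1)) p p≡t

    sumZero⇒InDir : ∀ v → sumℤ v ≡ + 0 → InDir n π v
    sumZero⇒InDir v Σv≡0 = n , pivots⇒sumZero⊆span u (λ k → sum-Δ {π = π} length-π (toℕ k)) pivot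
      (λ i → toℚ (v i)) (trans (toℚ-sum v) (cong toℚ Σv≡0))

open SumZeroLattice using (sumZeroLattice-basis)
open StackSorting using (perm-length; ln1-stage)
open AffineSpan using (InDir⇒sumZero; sumZero⇒InDir)

lemma4p2 : (n : ℕ) → 2 ≤ n → (π : List ℕ) → IsPerm n π → IsLn1 n π →
    (k : ℕ) (b : Fin k → Fin n → ℤ) → IsLatticeBasis n π b →
    (k ≡ n ∸ 1) × (det (gram b) ≡ + n)
lemma4p2 (suc (suc j₀)) (s≤s (s≤s z≤n)) π π↭ ln1 k b (b-parallel , b-independent , b-spans) =
  sumZeroLattice-basis b
    (λ j → InDir⇒sumZero {π = π} (perm-length π↭) (b j) (b-parallel j))
    b-independent
    (λ v Σv≡0 → b-spans v (sumZero⇒InDir (perm-length π↭) (ln1-stage π↭ ln1) v Σv≡0))
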